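{- Let $(W,S)$ be a finite Coxeter system, let $i\neq j$ with $m:=m_{ij}>3$, let $\mathsf Q,\mathsf Q'\in S^*$ be arbitrary words and let $\pi\in W$. Assume that conditions $(A_3)$ and $(B_3)$ hold. Then: (1) if both $(A_2)$ and $(B_2)$ hold, then $\Delta_1$ and $\Delta_2$ are isomorphic; (2) if $(A_2)$ does not hold but $(B_2)$ holds, then $\Delta_1$ is isomorphic to the edge $(m-2)$-subdivision $\mathrm{Sub}^{m-2}_G(\Delta_2)$ of $\Delta_2$ along $G$; (3) if $(A_2)$ holds but $(B_2)$ does not, then $\Delta_2$ is isomorphic to $\mathrm{Sub}^{m-2}_F(\Delta_1)$; (4) if neither $(A_2)$ nor $(B_2)$ holds, then there is a simplicial complex $\widetilde\Delta$ which is simultaneously (isomorphic to) $\mathrm{Sub}^{m-2}_F(\Delta_1)$ and $\mathrm{Sub}^{m-2}_G(\Delta_2)$. In particular, either $\Delta_1\cong\Delta_2$, or one of them is isomorphic to an edge $(m-2)$-subdivision of the other, or they have a common edge $(m-2)$-subdivision.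
   Context: $(W,S)$ is a finite Coxeter system, $S=\{s_1,\dots,s_n\}$, $m_{ij}$ is the order of $s_is_j$. $S^*$ is the set of words in the alphabet $S$ (the letter corresponding to $s$ is written $\mathsf s$); a word $\mathsf w_1\cdots\mathsf w_p$ expresses $w_1\cdots w_p\in W$ and is a reduced expression of it if $p$ equals the Coxeter length of that element. A word $\mathsf u$ contains $\mathsf v$ (as a subword) if $\mathsf v$ is obtained from $\mathsf u$ by deleting letters. For $\mathsf U=\mathsf u_1\cdots\mathsf u_r\in S^*$ and $\rho\in W$, the subword complex $\Delta(\mathsf U;\rho)$ is the simplicial complex on the vertex set of positions $\{1,\dots,r\}$ (distinct positions are distinct vertices even if the letters coincide) whose faces are the sets $I$ of positions such that the word formed by the letters at positions not in $I$ contains a reduced expression of $\rho$. Braid-move setting: for $0\le k\le m$ let $\mathsf w^k_{i,j}=\mathsf s_i\mathsf s_j\mathsf s_i\cdots$ be the alternating word of length $m-k$ starting with $\mathsf s_i$, and $\mathsf w^k_{j,i}$ the one starting with $\mathsf s_j$. Put $\mathsf Q^k_1=\mathsf Q\,\mathsf w^k_{i,j}\,\mathsf Q'$, $\mathsf Q^k_2=\mathsf Q\,\mathsf w^k_{j,i}\,\mathsf Q'$. Let $\mathsf f_l$ (resp. $\mathsf g_l$), $1\le l\le m$, be the position in $\mathsf Q_1^0$ (resp. $\mathsf Q_2^0$) of the $l$-th letter of the factor $\mathsf w^0_{i,j}$ (resp. $\mathsf w^0_{j,i}$). $F=\{\mathsf f_1,\mathsf f_m\}$, $G=\{\mathsf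 g_1,\mathsf g_m\}$, $\Delta_1=\Delta(\mathsf Q_1^0;\pi)$, $\Delta_2=\Delta(\mathsf Q_2^0;\pi)$. Condition $(A_k)$: $\mathsf Q^k_1$ contains no reduced expression of $\pi$; condition $(B_k)$: $\mathsf Q^k_2$ contains no reduced expression of $\pi$. Edge subdivisions: for a simplicial complex $X$ and a face $\sigma$, $\mathrm{Lk}_X(\sigma)=\{\rho\in X:\sigma\cup\rho\in X,\ \sigma\cap\rho=\emptyset\}$. For an edge $\eta=\{s,t\}\in X$ and a new vertex $r$, $\mathrm{Sub}_\eta(X)=\{\sigma\in X:\eta\not\subset\sigma\}\cup\{\sigma\cup\{r\},\sigma\cup\{r,s\},\sigma\cup\{r,t\}:\sigma\in\mathrm{Lk}_X(\eta)\}$. The edge $k$-subdivision $\mathrm{Sub}^k_\eta(X)$ is obtained by subdividing along $\{s,t\}$ with new vertex $r_1$, then along $\{r_1,t\}$ with new vertex $r_2$, ..., then along $\{r_{k-1},t\}$ with new vertex $r_k$. -}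

module Defs where

open import Data.Nat using (ℕ; zero; suc; _≤_; _<_; _∸_; s≤s; z≤n)
open import Data.Nat.Properties using (<-trans)
open import Data.Bool using (Bool; true; false)
open import Data.Fin as Fin using (Fin; zero; suc; _↑ˡ_; _↑ʳ_; fromℕ)
open import Data.Fin.Properties using (any?)
open import Data.Fin.Subset using (Subset; ⁅_⁆; _∪_; _∩_; _⊆_; ∁) renaming (⊥ to ∅)
open import Data.Fin.Subset.Properties using (_∈?_)
open import Data.Vec as Vec using (Vec; []; _∷_; tabulate)
open import Data.List as List using (List; []; _∷_; _++_; concat; replicate; length)
open import Data.List.Relation.Binary.Sublist.Propositional using () renaming (_⊆_ to _⊑_)
open import Data.List.Relation.Unary.Any using (Any)
open import Data.Product using (Σ; ∃; _×_; _,_)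
open import Data.Sum using (_⊎_)
open import Relation.Nullary using (¬_)
open import Relation.Nullary.Decidable using (⌊_⌋; _×-dec_)
open import Relation.Binary.PropositionalEquality using (_≡_; _≢_)

-- Coxeter matrices.  A Coxeter system (W,S) with S = {s_1..s_n} is
-- determined by its Coxeter matrix; W is the group presented by
-- generators S and relations (s_i s_j)^{m_ij} = 1 (m_ii = 1).

record CoxeterMatrix (n : ℕ) : Set where
  field
    m    : Fin n → Fin n → ℕ
    diag : ∀ i → m i i ≡ 1
    symm : ∀ i j → m i j ≡ m j i
    off  : ∀ i j → i ≢ j → 2 ≤ m i j

Word : ℕ → Set
Word n = List (Fin n)

pow2 : ∀ {n} → Fin n → Fin n → ℕ → Word n
pow2 i j k = concat (replicate k (i ∷ j ∷ []))

alt : ∀ {n} → Fin n → Fin n → (k : ℕ) → Vec (Fin n) k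
alt i j zero    = []
alt i j (suc k) = i ∷ alt j i k

module Coxeter {n : ℕ} (C : CoxeterMatrix n) where
  open CoxeterMatrix C

  -- Two words express the same element of W: the congruence on S*
  -- generated by the defining relations (s_i s_j)^{m_ij} = 1.
  -- (S* modulo this congruence is the Coxeter group W.)
  data _∼_ : Word n → Word n → Set where
    ∼-refl  : ∀ {u} → u ∼ u
    ∼-sym   : ∀ {u v} → u ∼ v → v ∼ u
    ∼-trans : ∀ {u v w} → u ∼ v → v ∼ w → u ∼ w
    ∼-rel   : ∀ u v i j → (u ++ pow2 i j (m i j) ++ v) ∼ (u ++ v)

  FiniteW : Set
  FiniteW = Σ (List (Word n)) λ ws → ∀ u → Any (λ w → u ∼ w) ws

  Reduced : Word n → Set
  Reduced v = ∀ u → u ∼ v → length v ≤ length u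

  ContainsRed : Word n → Word n → Set
  ContainsRed U p = Σ (Word n) λ v → (v ⊑ U) × Reduced v × (v ∼ p)

-- Finite simplicial complexes given by their faces: subsets of the
-- ambient vertex set Fin N.  Vertices of the complex are the v with
-- {v} a face.

record SC : Set₁ where
  field
    N    : ℕ
    Face : Subset N → Set

open SC public

Vertex : (X : SC) → Fin (N X) → Set
Vertex X v = Face X ⁅ v ⁆

image : ∀ {a b} → (Fin a → Fin b) → Subset a → Subset b
image f σ = tabulate (λ w → ⌊ any? (λ v → (v ∈? σ) ×-dec (f v Fin.≟ w)) ⌋)

record _≅_ (X Y : SC) : Set where
  field
    to      : Fin (N X) → Fin (N Y)
    from    : Fin (N Y) → Fin (N X)
    to-v    : ∀ v → Vertex X v → Vertex Y (to v)
    from-v  : ∀ w → Vertex Y w → Vertex X (from w)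
    from-to : ∀ v → Vertex X v → from (to v) ≡ v
    to-from : ∀ w → Vertex Y w → to (from w) ≡ w
    to-F    : ∀ σ → Face X σ → Face Y (image to σ)
    from-F  : ∀ τ → Face Y τ → Face X (image from τ)

Lk : (X : SC) → Subset (N X) → Subset (N X) → Set
Lk X σ ρ = Face X ρ × Face X (σ ∪ ρ) × (σ ∩ ρ ≡ ∅)

-- The new vertex r is `zero`
-- of Fin (suc N); old vertex v becomes `suc v`.  A subset of
-- Fin (suc N) is written b ∷ σ with b saying whether r belongs to it.
SubFace : (X : SC) → Fin (N X) → Fin (N X) → Subset (suc (N X)) → Set
SubFace X s t (false ∷ σ) = Face X σ × ¬ ((⁅ s ⁆ ∪ ⁅ t ⁆) ⊆ σ)
SubFace X s t (true ∷ σ)  =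
  Σ (Subset (N X)) λ ρ → Lk X (⁅ s ⁆ ∪ ⁅ t ⁆) ρ ×
    (σ ≡ ρ ⊎ σ ≡ ρ ∪ ⁅ s ⁆ ⊎ σ ≡ ρ ∪ ⁅ t ⁆)

Sub : (X : SC) → Fin (N X) → Fin (N X) → SC
Sub X s t = record { N = suc (N X) ; Face = SubFace X s t }

-- Edge k-subdivision: along {s,t} with r₁, then {r₁,t} with r₂, ...
SubK : ℕ → (X : SC) → Fin (N X) → Fin (N X) → SC
SubK zero    X s t = X
SubK (suc k) X s t = SubK k (Sub X s t) zero (suc t)

keep : ∀ {A : Set} {r} → Vec A r → Subset r → List A
keep []       []           = []
keep (x ∷ xs) (true  ∷ σ) = x ∷ keep xs σ
keep (x ∷ xs) (false ∷ σ) = keep xs σ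

module _ {n : ℕ} (C : CoxeterMatrix n) where
  open Coxeter C

  subwordComplex : ∀ {r} → Vec (Fin n) r → Word n → SC
  subwordComplex {r} U p = record
    { N = r ; Face = λ I → ContainsRed (keep U (∁ I)) p }

firstIdx : (m : ℕ) → 0 < m → Fin m
firstIdx (suc m) _ = zero

lastIdx : (m : ℕ) → 0 < m → Fin m
lastIdx (suc m) _ = fromℕ m

posIn : (a m b : ℕ) → Fin m → Fin (a Data.Nat.+ (m Data.Nat.+ b))
posIn a m b l = a ↑ʳ (l ↑ˡ b)

0<m : ∀ {m} → 3 < m → 0 < m
0<m h = <-trans (s≤s z≤n) (<-trans (s≤s (s≤s z≤n)) (<-trans (s≤s (s≤s (s≤s z≤n))) h))

module Submission where

-- Under (A₃)
-- and (B₃) the faces are rigid near the braid factor: a face deletes from w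
-- nothing, the last letter, the first letter, two adjacent letters or the two
-- end letters, according to the alternating word of length m, m-1 or m-2
-- that the remaining letters contribute to a reduced expression of π
-- (BraidMoves.Faces).  The edge (m-2)-subdivision along the end positions
-- {g₁, g_m} is described explicitly: its new vertices form a path from g₁ to
-- g_m, and a face either avoids the path or meets it in two consecutive
-- vertices (SimplicialComplexes.subK≅E).  Exchanging the braid positions of w
-- with the reversed path is an involution φ carrying faces of the
-- subdivision of Δ₁ to faces of the subdivision of Δ₂ (BraidMoves.Transfer),
-- so the two subdivisions are isomorphic.  Finally (B₂), resp. (A₂), forbids
-- faces meeting the path, and then Δ₁, resp. Δ₂, is isomorphic to its own
-- subdivision.  The four cases of the theorem compose these isomorphisms.

open import Defs

module Preliminaries where

  open import Data.Nat using (ℕ; zero; suc; _+_; _≤_; _∸_; s≤s; z≤n)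
  open import Data.Nat.Properties using (≤-trans; ≤-refl; n≤1+n; m≤m+n; 1+n≰n; suc-injective)
  open import Data.Bool using (true; false)
  open import Data.Fin using (Fin; zero; suc; fromℕ; inject₁; _↑ˡ_; _↑ʳ_)
  import Data.Fin.Properties
  open import Data.Product using (_×_; _,_; proj₁; proj₂)
  open import Data.Sum using (_⊎_; inj₁; inj₂)
  import Data.Sum
  open import Data.Empty using (⊥)
  open import Relation.Binary.PropositionalEquality using (_≡_; _≢_; refl; cong)

  true≢false : true ≢ false
  true≢false ()

  InPair : ℕ → ℕ → Set
  InPair c z = (z ≡ c) ⊎ (z ≡ suc c)

  InPair⇒bounds : ∀ {c z} → InPair c z → c ≤ z × z ≤ suc c
  InPair⇒bounds (inj₁ refl) = ≤-refl , n≤1+n _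
  InPair⇒bounds (inj₂ refl) = n≤1+n _ , ≤-refl

  InPair-far : ∀ {c} a d → InPair c a → InPair c (suc (suc a) + d) → ⊥
  InPair-far a d near far = 1+n≰n (≤-trans (m≤m+n (suc (suc a)) d) (≤-trans (proj₂ (InPair⇒bounds far)) (s≤s (proj₁ (InPair⇒bounds near)))))

  InPair-suc : ∀ {p z} → InPair p z → InPair (suc p) (suc z)
  InPair-suc = Data.Sum.map (cong suc) (cong suc)

  InPair-pred : ∀ {p z} → InPair (suc p) (suc z) → InPair p z
  InPair-pred = Data.Sum.map suc-injective suc-injective

  InPair-reflect : ∀ M c z → z ≤ M → InPair c z → InPair (M ∸ suc c) (M ∸ z)
  InPair-reflect M c z le (inj₁ refl) = lower M c le
    where
    lower : ∀ M c → c ≤ M → InPair (M ∸ suc c) (M ∸ c)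
    lower zero    zero    z≤n      = inj₁ refl
    lower (suc M) zero    z≤n      = inj₂ refl
    lower (suc M) (suc c) (s≤s le) = lower M c le
  InPair-reflect M c z le (inj₂ refl) = inj₁ refl

  data NearTop (k : ℕ) : ℕ → Set where
    below : ∀ {ℓ} → ℓ ≤ k → NearTop k ℓ
    top-2 : NearTop k (suc k)
    top-1 : NearTop k (suc (suc k))
    top   : NearTop k (suc (suc (suc k)))

  nearTop : ∀ k ℓ → ℓ ≤ suc (suc (suc k)) → NearTop k ℓ
  nearTop k       zero                      _  = below z≤n
  nearTop zero    (suc zero)                _  = top-2
  nearTop zero    (suc (suc zero))          _  = top-1
  nearTop zero    (suc (suc (suc zero)))    _  = top
  nearTop zero    (suc (suc (suc (suc ℓ)))) (s≤s (s≤s (s≤s ())))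
  nearTop (suc k) (suc ℓ)              (s≤s le) with nearTop k ℓ le
  ... | below le' = below (s≤s le')
  ... | top-2     = top-2
  ... | top-1     = top-1
  ... | top       = top

  data LastOrInner {n : ℕ} : Fin (suc n) → Set where
    isLast  : LastOrInner (fromℕ n)
    isInner : ∀ (l : Fin n) → LastOrInner (inject₁ l)

  lastOrInner : ∀ {n} (r : Fin (suc n)) → LastOrInner r
  lastOrInner {zero}  zero    = isLast
  lastOrInner {suc n} zero    = isInner zero
  lastOrInner {suc n} (suc r) with lastOrInner r
  ... | isLast    = isLast
  ... | isInner l = isInner (suc l)

  lastOrInner-last : ∀ n → lastOrInner (fromℕ n) ≡ isLast
  lastOrInner-last zero    = refl
  lastOrInner-last (suc n) rewrite lastOrInner-last n = refl

  lastOrInner-inner : ∀ {n} (l : Fin n) → lastOrInner (inject₁ l) ≡ isInner l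
  lastOrInner-inner {suc n} zero    = refl
  lastOrInner-inner {suc n} (suc l) rewrite lastOrInner-inner l = refl

  data LeftOrRight (a c : ℕ) : Fin (a + c) → Set where
    isLeft  : ∀ q → LeftOrRight a c (q ↑ˡ c)
    isRight : ∀ r → LeftOrRight a c (a ↑ʳ r)

  leftOrRight : ∀ a c (w : Fin (a + c)) → LeftOrRight a c w
  leftOrRight zero    c w       = isRight w
  leftOrRight (suc a) c zero    = isLeft zero
  leftOrRight (suc a) c (suc w) with leftOrRight a c w
  ... | isLeft q  = isLeft (suc q)
  ... | isRight r = isRight r

  leftOrRight-left : ∀ a c (q : Fin a) → leftOrRight a c (q ↑ˡ c) ≡ isLeft q
  leftOrRight-left (suc a) c zero    = refl
  leftOrRight-left (suc a) c (suc q) rewrite leftOrRight-left a c q = refl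

  leftOrRight-right : ∀ a c (r : Fin c) → leftOrRight a c (a ↑ʳ r) ≡ isRight r
  leftOrRight-right zero    c r = refl
  leftOrRight-right (suc a) c r rewrite leftOrRight-right a c r = refl

  ↑ˡ≢↑ʳ : ∀ a c (q : Fin a) (r : Fin c) → q ↑ˡ c ≢ a ↑ʳ r
  ↑ˡ≢↑ʳ (suc a) c zero    r ()
  ↑ˡ≢↑ʳ (suc a) c (suc q) r e = ↑ˡ≢↑ʳ a c q r (Data.Fin.Properties.suc-injective e)

module SimplicialComplexes where

  open Preliminaries
  open import Data.Nat using (ℕ; zero; suc)
  open import Data.Bool using (Bool; true; false; _∧_; _∨_; not)
  import Data.Bool
  open import Data.Bool.Properties using (¬-not; ∧-identityʳ; ∧-identityˡ; ∧-zeroʳ; ∨-zeroʳ; ∨-identityʳ)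
  open import Data.Fin as Fin using (Fin; zero; suc; toℕ)
  open import Data.Fin.Properties using (any?)
  import Data.Fin.Properties
  open import Data.Fin.Subset using (Subset; ⁅_⁆; _∪_; _∩_; _⊆_) renaming (⊥ to ∅)
  open import Data.Fin.Subset.Properties using (_∈?_; x∈⁅x⁆; x∈⁅y⁆⇒x≡y)
  open import Data.Vec using (Vec; _∷_; tabulate; lookup)
  open import Data.Vec.Properties using (lookup∘tabulate; tabulate∘lookup; tabulate-cong; []=⇒lookup; lookup⇒[]=; lookup-zipWith; lookup-replicate)
  open import Data.Product using (Σ; _×_; _,_; proj₁; proj₂)
  import Data.Product
  open import Data.Sum using (_⊎_; inj₁; inj₂)
  open import Relation.Nullary using (¬_; yes; no; does)
  open import Relation.Nullary.Decidable using (⌊_⌋; _×-dec_)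
  open import Relation.Binary.PropositionalEquality
  open import Data.Empty using (⊥-elim)
  open import Function using (_∘_)

  subset-ext : ∀ {A : Set} {N} {u v : Vec A N} → (∀ i → lookup u i ≡ lookup v i) → u ≡ v
  subset-ext {u = u} {v} p = trans (sym (tabulate∘lookup u)) (trans (tabulate-cong p) (tabulate∘lookup v))

  bool-ext : ∀ {b c : Bool} → (b ≡ true → c ≡ true) → (c ≡ true → b ≡ true) → b ≡ c
  bool-ext {false} {false} _ _ = refl
  bool-ext {false} {true}  _ g = g refl
  bool-ext {true}  {false} f _ = sym (f refl)
  bool-ext {true}  {true}  _ _ = refl

  ≟-true : ∀ {N} {v w : Fin N} → v ≡ w → ⌊ v Fin.≟ w ⌋ ≡ true
  ≟-true {v = v} {w} e with v Fin.≟ w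
  ... | yes _ = refl
  ... | no ne = ⊥-elim (ne e)

  ≟-false : ∀ {N} {v w : Fin N} → v ≢ w → ⌊ v Fin.≟ w ⌋ ≡ false
  ≟-false {v = v} {w} ne with v Fin.≟ w
  ... | yes e = ⊥-elim (ne e)
  ... | no _  = refl

  image-elim : ∀ {a b} (f : Fin a → Fin b) (σ : Subset a) w → lookup (image f σ) w ≡ true →
    Σ (Fin a) λ v → lookup σ v ≡ true × f v ≡ w
  image-elim f σ w e with any? (λ v → (v ∈? σ) ×-dec (f v Fin.≟ w))
                        | lookup∘tabulate (λ w → ⌊ any? (λ v → (v ∈? σ) ×-dec (f v Fin.≟ w)) ⌋) w
  ... | yes (v , v∈σ , fv≡w) | _ = v , []=⇒lookup v∈σ , fv≡w
  ... | no _ | q with trans (sym q) e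
  ...   | ()

  image-intro : ∀ {a b} (f : Fin a → Fin b) (σ : Subset a) v → lookup σ v ≡ true → lookup (image f σ) (f v) ≡ true
  image-intro f σ v e with any? (λ u → (u ∈? σ) ×-dec (f u Fin.≟ f v))
                         | lookup∘tabulate (λ w → ⌊ any? (λ u → (u ∈? σ) ×-dec (f u Fin.≟ w)) ⌋) (f v)
  ... | yes _ | q = q
  ... | no ¬p | _ = ⊥-elim (¬p (v , lookup⇒[]= v σ e , refl))

  singleton-elim : ∀ {N} (v u : Fin N) → lookup ⁅ v ⁆ u ≡ true → u ≡ v
  singleton-elim v u e = x∈⁅y⁆⇒x≡y v (lookup⇒[]= u ⁅ v ⁆ e)

  singleton-intro : ∀ {N} (v : Fin N) → lookup ⁅ v ⁆ v ≡ true
  singleton-intro v = []=⇒lookup (x∈⁅x⁆ v)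

  image-singleton : ∀ {a b} (f : Fin a → Fin b) v → image f ⁅ v ⁆ ≡ ⁅ f v ⁆
  image-singleton f v = subset-ext λ w → bool-ext
    (λ e → let (u , u∈ , fu≡w) = image-elim f ⁅ v ⁆ w e
           in subst (λ z → lookup ⁅ f v ⁆ z ≡ true) (trans (cong f (sym (singleton-elim v u u∈))) fu≡w) (singleton-intro (f v)))
    (λ e → subst (λ z → lookup (image f ⁅ v ⁆) z ≡ true) (sym (singleton-elim (f v) w e)) (image-intro f ⁅ v ⁆ v (singleton-intro v)))

  image-section : ∀ {a b} (f : Fin a → Fin b) (g : Fin b → Fin a) → (∀ v → g (f v) ≡ v) → (σ : Subset a) →
    image f σ ≡ tabulate (λ w → lookup σ (g w) ∧ ⌊ f (g w) Fin.≟ w ⌋)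
  image-section f g gf σ = subset-ext λ w → trans (bool-ext (into w) (outof w)) (sym (lookup∘tabulate _ w))
    where
    into : ∀ w → lookup (image f σ) w ≡ true → (lookup σ (g w) ∧ ⌊ f (g w) Fin.≟ w ⌋) ≡ true
    into w e with image-elim f σ w e
    ... | u , u∈ , refl rewrite gf u | u∈ = ≟-true refl
    outof : ∀ w → (lookup σ (g w) ∧ ⌊ f (g w) Fin.≟ w ⌋) ≡ true → lookup (image f σ) w ≡ true
    outof w e with lookup σ (g w) in gw∈ | f (g w) Fin.≟ w
    outof w e | true | yes fgw≡w = subst (λ z → lookup (image f σ) z ≡ true) fgw≡w (image-intro f σ (g w) gw∈)

  image-retraction : ∀ {a b} (f : Fin a → Fin b) (g : Fin b → Fin a) → (∀ v → g (f v) ≡ v) → (τ : Subset b) →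
    (∀ w → lookup τ w ≡ true → f (g w) ≡ w) → image g τ ≡ tabulate (λ v → lookup τ (f v))
  image-retraction f g gf τ inRange = subset-ext λ v → trans (bool-ext (into v) (outof v)) (sym (lookup∘tabulate _ v))
    where
    into : ∀ v → lookup (image g τ) v ≡ true → lookup τ (f v) ≡ true
    into v e with image-elim g τ v e
    ... | w , w∈ , refl = subst (λ z → lookup τ z ≡ true) (sym (inRange w w∈)) w∈
    outof : ∀ v → lookup τ (f v) ≡ true → lookup (image g τ) v ≡ true
    outof v e = subst (λ z → lookup (image g τ) z ≡ true) (gf v) (image-intro g τ (f v) e)

  image-∘ : ∀ {a b c} (f : Fin a → Fin b) (g : Fin b → Fin c) (σ : Subset a) → image g (image f σ) ≡ image (λ v → g (f v)) σ
  image-∘ f g σ = subset-ext λ w → bool-ext (into w) (outof w)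
    where
    into : ∀ w → lookup (image g (image f σ)) w ≡ true → lookup (image (λ v → g (f v)) σ) w ≡ true
    into w e with image-elim g (image f σ) w e
    ... | u , u∈ , refl with image-elim f σ u u∈
    ...   | v , v∈ , refl = image-intro (λ v → g (f v)) σ v v∈
    outof : ∀ w → lookup (image (λ v → g (f v)) σ) w ≡ true → lookup (image g (image f σ)) w ≡ true
    outof w e with image-elim (λ v → g (f v)) σ w e
    ... | v , v∈ , refl = image-intro g (image f σ) (f v) (image-intro f σ v v∈)

  -- An isomorphism is conveniently built from a map `to` with a left
  -- inverse `from`, such that `to ∘ from` is the identity on vertices of
  -- faces of Y, and faces correspond (stated through tabulations, which
  -- avoids computing images).
  record IsoByRetraction (X Y : SC) : Set where
    field
      to        : Fin (N X) → Fin (N Y)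
      from      : Fin (N Y) → Fin (N X)
      from-to   : ∀ v → from (to v) ≡ v
      to-from   : ∀ τ → Face Y τ → ∀ w → lookup τ w ≡ true → to (from w) ≡ w
      to-face   : ∀ σ → Face X σ → Face Y (tabulate (λ w → lookup σ (from w) ∧ ⌊ to (from w) Fin.≟ w ⌋))
      from-face : ∀ τ → Face Y τ → Face X (tabulate (λ v → lookup τ (to v)))

  mkIso : ∀ {X Y} → IsoByRetraction X Y → X ≅ Y
  mkIso {X} {Y} d = record
    { to = to ; from = from
    ; to-v = λ v p → subst (Face Y) (image-singleton to v) (toF ⁅ v ⁆ p)
    ; from-v = λ w p → subst (Face X) (image-singleton from w) (fromF ⁅ w ⁆ p)
    ; from-to = λ v _ → from-to v
    ; to-from = λ w p → to-from ⁅ w ⁆ p w (singleton-intro w)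
    ; to-F = toF ; from-F = fromF }
    where
    open IsoByRetraction d
    toF : ∀ σ → Face X σ → Face Y (image to σ)
    toF σ p = subst (Face Y) (sym (image-section to from from-to σ)) (to-face σ p)
    fromF : ∀ τ → Face Y τ → Face X (image from τ)
    fromF τ p = subst (Face X) (sym (image-retraction to from from-to τ (to-from τ p))) (from-face τ p)

  ≅-sameVertices : ∀ (X : SC) (F : Subset (N X) → Set) → (∀ σ → Face X σ → F σ) → (∀ σ → F σ → Face X σ) →
    X ≅ record { N = N X ; Face = F }
  ≅-sameVertices X F f g = mkIso record
    { to = λ v → v ; from = λ v → v ; from-to = λ _ → refl ; to-from = λ _ _ _ _ → refl
    ; to-face = λ σ p → subst F (sym (subset-ext λ w → trans (lookup∘tabulate _ w) (drop-test σ w))) (f σ p)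
    ; from-face = λ τ p → subst (Face X) (sym (tabulate∘lookup τ)) (g τ p) }
    where
    drop-test : ∀ (σ : Subset (N X)) w → (lookup σ w ∧ ⌊ w Fin.≟ w ⌋) ≡ lookup σ w
    drop-test σ w = trans (cong (lookup σ w ∧_) (≟-true refl)) (∧-identityʳ (lookup σ w))

  ≅-refl : ∀ {X} → X ≅ X
  ≅-refl {X} = ≅-sameVertices X (Face X) (λ _ p → p) (λ _ p → p)

  ≅-sym : ∀ {X Y} → X ≅ Y → Y ≅ X
  ≅-sym i = record { to = from ; from = to ; to-v = from-v ; from-v = to-v
                   ; from-to = to-from ; to-from = from-to ; to-F = from-F ; from-F = to-F }
    where open _≅_ i

  ≅-trans : ∀ {X Y Z} → X ≅ Y → Y ≅ Z → X ≅ Z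
  ≅-trans {X} {Y} {Z} i j = record
    { to = λ v → J.to (I.to v) ; from = λ w → I.from (J.from w)
    ; to-v = λ v p → J.to-v _ (I.to-v v p) ; from-v = λ w p → I.from-v _ (J.from-v w p)
    ; from-to = λ v p → trans (cong I.from (J.from-to _ (I.to-v v p))) (I.from-to v p)
    ; to-from = λ w p → trans (cong J.to (I.to-from _ (J.from-v w p))) (J.to-from w p)
    ; to-F = λ σ p → subst (Face Z) (image-∘ I.to J.to σ) (J.to-F _ (I.to-F σ p))
    ; from-F = λ τ p → subst (Face X) (image-∘ J.from I.from τ) (I.from-F _ (J.from-F τ p)) }
    where
    module I = _≅_ i
    module J = _≅_ j

  -- Vertex sets of iterated subdivisions: k ⊕ N = k + N, computed so that
  -- the vertex set of SubK k X s t is definitionally Fin (k ⊕ N X).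
  _⊕_ : ℕ → ℕ → ℕ
  zero  ⊕ n = n
  suc k ⊕ n = k ⊕ suc n

  -- An old vertex of X, and the new vertex r_{l+1}, in Fin (k ⊕ N).
  oldV : ∀ k {N} → Fin N → Fin (k ⊕ N)
  oldV zero    v = v
  oldV (suc k) v = oldV k (suc v)

  newV : ∀ k {N} → Fin k → Fin (k ⊕ N)
  newV (suc k) zero    = oldV k zero
  newV (suc k) (suc l) = newV k l

  data VertexView (k N : ℕ) : Fin (k ⊕ N) → Set where
    isOld : ∀ v → VertexView k N (oldV k v)
    isNew : ∀ l → VertexView k N (newV k l)

  vertexView : ∀ k {N} (w : Fin (k ⊕ N)) → VertexView k N w
  vertexView zero    w = isOld w
  vertexView (suc k) w with vertexView k w
  ... | isOld zero    = isNew zero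
  ... | isOld (suc v) = isOld v
  ... | isNew l       = isNew (suc l)

  oldV-injective : ∀ k {N} {v v' : Fin N} → oldV k v ≡ oldV k v' → v ≡ v'
  oldV-injective zero    e = e
  oldV-injective (suc k) e = Data.Fin.Properties.suc-injective (oldV-injective k e)

  oldV≢newV : ∀ k {N} (v : Fin N) (l : Fin k) → oldV k v ≢ newV k l
  oldV≢newV (suc k) v zero    e with oldV-injective k e
  ... | ()
  oldV≢newV (suc k) v (suc l) e = oldV≢newV k (suc v) l e

  vertexView-old : ∀ k {N} (v : Fin N) → vertexView k (oldV k v) ≡ isOld v
  vertexView-old zero    v = refl
  vertexView-old (suc k) v rewrite vertexView-old k (suc v) = refl

  vertexView-new : ∀ k {N} (l : Fin k) → vertexView k {N} (newV k l) ≡ isNew l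
  vertexView-new (suc k) {N} zero    rewrite vertexView-old k {suc N} zero = refl
  vertexView-new (suc k) {N} (suc l) rewrite vertexView-new k {suc N} l = refl

  -- Boolean tests for equality of vertices and membership in {s, t}.  (They
  -- use `does` so that suc v =ᵇ suc t computes to v =ᵇ t.)
  _=ᵇ_ : ∀ {N} → Fin N → Fin N → Bool
  v =ᵇ s = does (v Fin.≟ s)

  =ᵇ-sound : ∀ {N} {v s : Fin N} → v =ᵇ s ≡ true → v ≡ s
  =ᵇ-sound {v = v} {s} e with v Fin.≟ s
  ... | yes p = p

  =ᵇ-refl : ∀ {N} (v : Fin N) → v =ᵇ v ≡ true
  =ᵇ-refl v with v Fin.≟ v
  ... | yes _ = refl
  ... | no ne = ⊥-elim (ne refl)

  =ᵇ-false : ∀ {N} {v s : Fin N} → v ≢ s → v =ᵇ s ≡ false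
  =ᵇ-false {v = v} {s} ne with v Fin.≟ s
  ... | yes p = ⊥-elim (ne p)
  ... | no _ = refl

  inEdge : ∀ {N} → Fin N → Fin N → Fin N → Bool
  inEdge s t v = (v =ᵇ s) ∨ (v =ᵇ t)

  lookup-⁅⁆ : ∀ {N} (s v : Fin N) → lookup ⁅ s ⁆ v ≡ v =ᵇ s
  lookup-⁅⁆ s v = bool-ext (λ e → subst (λ z → z =ᵇ s ≡ true) (sym (singleton-elim s v e)) (=ᵇ-refl s))
                           (λ e → subst (λ z → lookup ⁅ s ⁆ z ≡ true) (sym (=ᵇ-sound e)) (singleton-intro s))

  lookup-∪ : ∀ {N} (p q : Subset N) v → lookup (p ∪ q) v ≡ lookup p v ∨ lookup q v
  lookup-∪ p q v = lookup-zipWith _∨_ v p q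

  lookup-∩ : ∀ {N} (p q : Subset N) v → lookup (p ∩ q) v ≡ lookup p v ∧ lookup q v
  lookup-∩ p q v = lookup-zipWith _∧_ v p q

  lookup-edge : ∀ {N} (s t v : Fin N) → lookup (⁅ s ⁆ ∪ ⁅ t ⁆) v ≡ inEdge s t v
  lookup-edge s t v = trans (lookup-∪ ⁅ s ⁆ ⁅ t ⁆ v) (cong₂ _∨_ (lookup-⁅⁆ s v) (lookup-⁅⁆ t v))

  lookup-∅ : ∀ {N} (v : Fin N) → lookup (∅ {N}) v ≡ false
  lookup-∅ v = lookup-replicate v false

  face-cong : ∀ (X : SC) {f g : Fin (N X) → Bool} → (∀ v → f v ≡ g v) → Face X (tabulate f) → Face X (tabulate g)
  face-cong X h = subst (Face X) (tabulate-cong h)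

  -- Explicit description of the faces of the edge k-subdivision of X along
  -- {s,t}: the new vertices r₁ … r_k form, together with s = r₀ and
  -- t = r_{k+1}, a path; a face either avoids the path, and is a face of X
  -- not containing both s and t, or meets it in at most two consecutive
  -- path vertices and is a face of X both without and with {s,t}.
  module ExplicitSubdivision (k : ℕ) (X : SC) (s t : Fin (N X)) where

    newIn : Subset (k ⊕ N X) → Fin k → Bool
    newIn τ l = lookup τ (newV k l)

    oldIn : Subset (k ⊕ N X) → Fin (N X) → Bool
    oldIn τ v = lookup τ (oldV k v)

    PathWithin : Subset (k ⊕ N X) → ℕ → Set
    PathWithin τ p = (∀ l → newIn τ l ≡ true → InPair p (suc (toℕ l))) ×
                     (oldIn τ s ≡ true → InPair p 0) × (oldIn τ t ≡ true → InPair p (suc k))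

    data KFace (τ : Subset (k ⊕ N X)) : Set where
      avoidsPath : (∀ l → newIn τ l ≡ false) → Face X (tabulate (oldIn τ)) →
                   ¬ (oldIn τ s ≡ true × oldIn τ t ≡ true) → KFace τ
      meetsPath  : (Σ (Fin k) λ l → newIn τ l ≡ true) →
                   Face X (tabulate (λ v → oldIn τ v ∧ not (inEdge s t v))) →
                   Face X (tabulate (λ v → oldIn τ v ∨ inEdge s t v)) →
                   Σ ℕ (PathWithin τ) → KFace τ

    E : SC
    E = record { N = k ⊕ N X ; Face = KFace }

  module OneSubdivision (X : SC) (s t : Fin (N X)) (s≢t : s ≢ t) where
    η : Subset (N X)
    η = ⁅ s ⁆ ∪ ⁅ t ⁆

    S : Fin (N X) → Bool
    S = inEdge s t

    edge⊆⇒ : ∀ (f : Fin (N X) → Bool) → η ⊆ tabulate f → f s ≡ true × f t ≡ true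
    edge⊆⇒ f h = member s (trans (lookup-edge s t s) (cong (_∨ (s =ᵇ t)) (=ᵇ-refl s))) ,
                 member t (trans (lookup-edge s t t) (trans (cong ((t =ᵇ s) ∨_) (=ᵇ-refl t)) (∨-zeroʳ _)))
      where
      member : ∀ v → lookup η v ≡ true → f v ≡ true
      member v e = trans (sym (lookup∘tabulate f v)) ([]=⇒lookup (h (lookup⇒[]= v η e)))

    ⇒edge⊆ : ∀ (f : Fin (N X) → Bool) → f s ≡ true → f t ≡ true → η ⊆ tabulate f
    ⇒edge⊆ f fs ft {v} v∈η = lookup⇒[]= v (tabulate f) (trans (lookup∘tabulate f v) (endpoint (trans (sym (lookup-edge s t v)) ([]=⇒lookup v∈η))))
      where
      endpoint : (v =ᵇ s) ∨ (v =ᵇ t) ≡ true → f v ≡ true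
      endpoint e with v Fin.≟ s | v Fin.≟ t
      ... | yes refl | _        = fs
      ... | no _     | yes refl = ft

    subFace-old⇒ : ∀ f → Face (Sub X s t) (false ∷ tabulate f) → Face X (tabulate f) × ¬ (f s ≡ true × f t ≡ true)
    subFace-old⇒ f (F , ∌η) = F , λ (fs , ft) → ∌η (⇒edge⊆ f fs ft)

    subFace-old⇐ : ∀ f → Face X (tabulate f) → ¬ (f s ≡ true × f t ≡ true) → Face (Sub X s t) (false ∷ tabulate f)
    subFace-old⇐ f F ∌η = F , λ h → ∌η (edge⊆⇒ f h)

    -- σ = ρ ∪ C with C ⊆ {s,t} and ρ disjoint from {s,t}: then σ∖{s,t} = ρ
    -- and σ ∪ {s,t} = {s,t} ∪ ρ.
    private
      split-by-edge : ∀ (F R Cc Sv : Bool) → F ≡ R ∨ Cc → (Sv ∧ R) ≡ false → (Cc ≡ true → Sv ≡ true) →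
        ((F ∧ not Sv) ≡ R) × ((F ∨ Sv) ≡ (Sv ∨ R))
      split-by-edge F true  Cc    true  e₁ () e₃
      split-by-edge F true  Cc    false refl e₂ e₃ = refl , refl
      split-by-edge F false true  true  refl e₂ e₃ = refl , refl
      split-by-edge F false true  false refl e₂ e₃ with e₃ refl
      ... | ()
      split-by-edge F false false true  refl e₂ e₃ = refl , refl
      split-by-edge F false false false refl e₂ e₃ = refl , refl

    module _ (f : Fin (N X) → Bool) (ρ : Subset (N X)) (disjoint : η ∩ ρ ≡ ∅) where
      private
        disjoint-at : ∀ v → (S v ∧ lookup ρ v) ≡ false
        disjoint-at v = trans (sym (cong (_∧ lookup ρ v) (lookup-edge s t v)))
                          (trans (sym (lookup-∩ η ρ v)) (trans (cong (λ z → lookup z v) disjoint) (lookup-∅ v)))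

      s∉ρ : lookup ρ s ≡ false
      s∉ρ = trans (sym (∧-identityˡ _)) (trans (cong (_∧ lookup ρ s) (sym (cong (_∨ (s =ᵇ t)) (=ᵇ-refl s)))) (disjoint-at s))

      t∉ρ : lookup ρ t ≡ false
      t∉ρ = trans (sym (∧-identityˡ _)) (trans (cong (_∧ lookup ρ t) (sym (trans (cong ((t =ᵇ s) ∨_) (=ᵇ-refl t)) (∨-zeroʳ _)))) (disjoint-at t))

      link-faces : Face X ρ → Face X (η ∪ ρ) → (Cf : Fin (N X) → Bool) → (∀ v → f v ≡ lookup ρ v ∨ Cf v) →
        (∀ v → Cf v ≡ true → S v ≡ true) →
        Face X (tabulate (λ v → f v ∧ not (S v))) × Face X (tabulate (λ v → f v ∨ S v))
      link-faces Fρ Fηρ Cf f≡ C⊆S =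
        face-cong X (λ v → sym (proj₁ (pointwise v))) (subst (Face X) (sym (tabulate∘lookup ρ)) Fρ) ,
        face-cong X (λ v → trans (lookup-∪ η ρ v) (trans (cong (_∨ lookup ρ v) (lookup-edge s t v)) (sym (proj₂ (pointwise v)))))
          (subst (Face X) (sym (tabulate∘lookup (η ∪ ρ))) Fηρ)
        where
        pointwise : ∀ v → ((f v ∧ not (S v)) ≡ lookup ρ v) × ((f v ∨ S v) ≡ (S v ∨ lookup ρ v))
        pointwise v = split-by-edge (f v) (lookup ρ v) (Cf v) (S v) (f≡ v) (disjoint-at v) (C⊆S v)

    subFace-new⇒ : ∀ f → Face (Sub X s t) (true ∷ tabulate f) →
      Face X (tabulate (λ v → f v ∧ not (S v))) × Face X (tabulate (λ v → f v ∨ S v)) × ¬ (f s ≡ true × f t ≡ true)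
    subFace-new⇒ f (ρ , (Fρ , Fηρ , dis) , inj₁ e) =
      Data.Product.map₂ (_, λ (fs , _) → true≢false (trans (sym fs) (trans (f≡ s) (cong (_∨ false) (s∉ρ f ρ dis)))))
        (link-faces f ρ dis Fρ Fηρ (λ _ → false) f≡ (λ v ()))
      where
      f≡ : ∀ v → f v ≡ lookup ρ v ∨ false
      f≡ v = trans (sym (lookup∘tabulate f v)) (trans (cong (λ z → lookup z v) e) (sym (∨-identityʳ _)))
    subFace-new⇒ f (ρ , (Fρ , Fηρ , dis) , inj₂ (inj₁ e)) =
      Data.Product.map₂ (_, λ (_ , ft) → true≢false (trans (sym ft) (trans (f≡ t) (cong₂ _∨_ (t∉ρ f ρ dis) (=ᵇ-false (s≢t ∘ sym))))))
        (link-faces f ρ dis Fρ Fηρ (_=ᵇ s) f≡ (λ v e → cong (_∨ (v =ᵇ t)) e))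
      where
      f≡ : ∀ v → f v ≡ lookup ρ v ∨ (v =ᵇ s)
      f≡ v = trans (sym (lookup∘tabulate f v)) (trans (cong (λ z → lookup z v) e) (trans (lookup-∪ ρ ⁅ s ⁆ v) (cong (lookup ρ v ∨_) (lookup-⁅⁆ s v))))
    subFace-new⇒ f (ρ , (Fρ , Fηρ , dis) , inj₂ (inj₂ e)) =
      Data.Product.map₂ (_, λ (fs , _) → true≢false (trans (sym fs) (trans (f≡ s) (cong₂ _∨_ (s∉ρ f ρ dis) (=ᵇ-false s≢t)))))
        (link-faces f ρ dis Fρ Fηρ (_=ᵇ t) f≡ (λ v e → trans (cong ((v =ᵇ s) ∨_) e) (∨-zeroʳ _)))
      where
      f≡ : ∀ v → f v ≡ lookup ρ v ∨ (v =ᵇ t)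
      f≡ v = trans (sym (lookup∘tabulate f v)) (trans (cong (λ z → lookup z v) e) (trans (lookup-∪ ρ ⁅ t ⁆ v) (cong (lookup ρ v ∨_) (lookup-⁅⁆ t v))))

    private
      restore : ∀ (f C : Fin (N X) → Bool) → f s ≡ C s → f t ≡ C t → (∀ v → v ≢ s → v ≢ t → C v ≡ false) →
        ∀ v → f v ≡ (f v ∧ not (S v)) ∨ C v
      restore f C fs ft Cout v with v Fin.≟ s | v Fin.≟ t
      ... | yes refl | _        = trans fs (cong (_∨ C s) (sym (∧-zeroʳ (f s))))
      ... | no _     | yes refl = trans ft (cong (_∨ C t) (sym (∧-zeroʳ (f t))))
      ... | no v≢s   | no v≢t   rewrite Cout v v≢s v≢t = sym (trans (∨-identityʳ _) (∧-identityʳ _))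

      removed-disjoint : ∀ a b → (a ∧ (b ∧ not a)) ≡ false
      removed-disjoint true  b = ∧-zeroʳ b
      removed-disjoint false b = refl

      removed-union : ∀ a b → (a ∨ (b ∧ not a)) ≡ (b ∨ a)
      removed-union true  b = sym (∨-zeroʳ b)
      removed-union false b = trans (∧-identityʳ b) (sym (∨-identityʳ b))

    subFace-new⇐ : ∀ f → Face X (tabulate (λ v → f v ∧ not (S v))) → Face X (tabulate (λ v → f v ∨ S v)) →
      ¬ (f s ≡ true × f t ≡ true) → Face (Sub X s t) (true ∷ tabulate f)
    subFace-new⇐ f F₋ F₊ ∌η = ρ₀ , (F₋ , subst (Face X) (subset-ext union) F₊ , subset-ext disjoint) , byEndpoints (f s) (f t) refl refl
      where
      ρ₀ : Subset (N X)
      ρ₀ = tabulate (λ v → f v ∧ not (S v))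
      union : ∀ v → lookup (tabulate (λ v → f v ∨ S v)) v ≡ lookup (η ∪ ρ₀) v
      union v = sym (begin
        lookup (η ∪ ρ₀) v                      ≡⟨ lookup-∪ η ρ₀ v ⟩
        lookup η v ∨ lookup ρ₀ v               ≡⟨ cong₂ _∨_ (lookup-edge s t v) (lookup∘tabulate _ v) ⟩
        S v ∨ (f v ∧ not (S v))                ≡⟨ removed-union (S v) (f v) ⟩
        f v ∨ S v                              ≡⟨ lookup∘tabulate (λ v → f v ∨ S v) v ⟨
        lookup (tabulate (λ v → f v ∨ S v)) v  ∎)
        where open ≡-Reasoning
      disjoint : ∀ v → lookup (η ∩ ρ₀) v ≡ lookup ∅ v
      disjoint v = trans (lookup-∩ η ρ₀ v) (trans (cong₂ _∧_ (lookup-edge s t v) (lookup∘tabulate _ v))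
                     (trans (removed-disjoint (S v) (f v)) (sym (lookup-∅ v))))
      addBack : ∀ C → f s ≡ C s → f t ≡ C t → (∀ v → v ≢ s → v ≢ t → C v ≡ false) →
        ∀ v → lookup (tabulate f) v ≡ lookup ρ₀ v ∨ C v
      addBack C fs ft Cout v = trans (lookup∘tabulate f v)
        (trans (restore f C fs ft Cout v) (cong (_∨ C v) (sym (lookup∘tabulate _ v))))
      plus : ∀ r → ∀ v → lookup (ρ₀ ∪ ⁅ r ⁆) v ≡ lookup ρ₀ v ∨ (v =ᵇ r)
      plus r v = trans (lookup-∪ ρ₀ ⁅ r ⁆ v) (cong (lookup ρ₀ v ∨_) (lookup-⁅⁆ r v))
      byEndpoints : ∀ bs bt → f s ≡ bs → f t ≡ bt →
        (tabulate f ≡ ρ₀) ⊎ (tabulate f ≡ ρ₀ ∪ ⁅ s ⁆) ⊎ (tabulate f ≡ ρ₀ ∪ ⁅ t ⁆)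
      byEndpoints true  true  fs ft = ⊥-elim (∌η (fs , ft))
      byEndpoints false false fs ft = inj₁ (subset-ext λ v →
        trans (addBack (λ _ → false) fs ft (λ _ _ _ → refl) v) (∨-identityʳ _))
      byEndpoints true  false fs ft = inj₂ (inj₁ (subset-ext λ v →
        trans (addBack (_=ᵇ s) (trans fs (sym (=ᵇ-refl s))) (trans ft (sym (=ᵇ-false (s≢t ∘ sym)))) (λ v v≢s _ → =ᵇ-false v≢s) v)
              (sym (plus s v))))
      byEndpoints false true  fs ft = inj₂ (inj₂ (subset-ext λ v →
        trans (addBack (_=ᵇ t) (trans fs (sym (=ᵇ-false s≢t))) (trans ft (sym (=ᵇ-refl t))) (λ v _ v≢t → =ᵇ-false v≢t) v)
              (sym (plus t v))))

  open ExplicitSubdivision using (E; KFace; avoidsPath; meetsPath; newIn)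

  module IteratedSubdivision (X : SC) (s t : Fin (N X)) (s≢t : s ≢ t) where
    open OneSubdivision X s t s≢t

    base : Sub X s t ≅ E 1 X s t
    base = ≅-sameVertices (Sub X s t) (KFace 1 X s t) to from
      where
      to : ∀ τ → Face (Sub X s t) τ → KFace 1 X s t τ
      to (false ∷ σ) F with subFace-old⇒ (lookup σ) (subst (λ z → Face (Sub X s t) (false ∷ z)) (sym (tabulate∘lookup σ)) F)
      ... | F' , ∌η = avoidsPath (λ { zero → refl }) F' ∌η
      to (true ∷ σ) F with subFace-new⇒ (lookup σ) (subst (λ z → Face (Sub X s t) (true ∷ z)) (sym (tabulate∘lookup σ)) F)
      ... | F₋ , F₊ , ∌η = meetsPath (zero , refl) F₋ F₊ (position (lookup σ s) refl)
        where
        position : ∀ b → lookup σ s ≡ b → Σ ℕ (ExplicitSubdivision.PathWithin 1 X s t (true ∷ σ))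
        position true  e = 0 , (λ { zero _ → inj₂ refl }) , (λ _ → inj₁ refl) , (λ et → ⊥-elim (∌η (e , et)))
        position false e = 1 , (λ { zero _ → inj₁ refl }) , (λ es → ⊥-elim (true≢false (trans (sym es) e))) , (λ _ → inj₂ refl)
      from : ∀ τ → KFace 1 X s t τ → Face (Sub X s t) τ
      from (false ∷ σ) (avoidsPath _ F ∌η) =
        subst (λ z → Face (Sub X s t) (false ∷ z)) (tabulate∘lookup σ) (subFace-old⇐ (lookup σ) F ∌η)
      from (true ∷ σ) (avoidsPath none _ _) with none zero
      ... | ()
      from (false ∷ σ) (meetsPath (zero , ()) _ _ _)
      from (true ∷ σ) (meetsPath _ F₋ F₊ (p , _ , atS , atT)) =
        subst (λ z → Face (Sub X s t) (true ∷ z)) (tabulate∘lookup σ) (subFace-new⇐ (lookup σ) F₋ F₊ ∌η)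
        where
        ∌η : ¬ (lookup σ s ≡ true × lookup σ t ≡ true)
        ∌η (es , et) with atS es | atT et
        ... | inj₁ refl | inj₁ ()
        ... | inj₁ refl | inj₂ ()

    -- Subdividing Sub X s t along {r₁, t} K more times is subdividing X along
    -- {s,t} K+1 times: both explicit descriptions live on the same vertex
    -- set, the path r₁, r₂, …, t of the former being the tail of s, r₁, …, t.
    module Step (k : ℕ) where
      K : ℕ
      K = suc k

      Y : SC
      Y = Sub X s t

      r₁In : Subset (suc K ⊕ N X) → Bool
      r₁In τ = lookup τ (oldV K {suc (N X)} zero)
      xIn : Subset (suc K ⊕ N X) → Fin (N X) → Bool
      xIn τ v = lookup τ (oldV K {suc (N X)} (suc v))

      withT : Subset (suc K ⊕ N X) → Fin (N X) → Bool
      withT τ v = xIn τ v ∨ (v =ᵇ t)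

      withoutT : Subset (suc K ⊕ N X) → Fin (N X) → Bool
      withoutT τ v = xIn τ v ∧ not (v =ᵇ t)

      private
        retype : ∀ {b c : Bool} {σ : Subset (N X)} → b ≡ c → Face Y (b ∷ σ) → Face Y (c ∷ σ)
        retype {σ = σ} e = subst (λ z → Face Y (z ∷ σ)) e

        minus-absorbs : ∀ a c d → ((a ∨ c) ∧ not (d ∨ c)) ≡ (a ∧ not (d ∨ c))
        minus-absorbs a true  d rewrite ∨-zeroʳ d = trans (∧-zeroʳ _) (sym (∧-zeroʳ a))
        minus-absorbs a false d = cong (_∧ not (d ∨ false)) (∨-identityʳ a)

        plus-absorbs : ∀ a c d → ((a ∨ c) ∨ (d ∨ c)) ≡ (a ∨ (d ∨ c))
        plus-absorbs a true  d rewrite ∨-zeroʳ d | ∨-zeroʳ a = refl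
        plus-absorbs a false d rewrite ∨-identityʳ a = refl

      to : ∀ τ → KFace K Y zero (suc t) τ → KFace (suc K) X s t τ
      to τ (avoidsPath none F ∌η) = avoiding (r₁In τ) refl F
        where
        avoiding : ∀ b → r₁In τ ≡ b → Face Y (b ∷ tabulate (xIn τ)) → KFace (suc K) X s t τ
        avoiding false r₁∉ F' with subFace-old⇒ (xIn τ) F'
        ... | F'' , ∌η' = avoidsPath (λ { zero → r₁∉ ; (suc l) → none l }) F'' ∌η'
        avoiding true r₁∈ F' with subFace-new⇒ (xIn τ) F'
        ... | F₋ , F₊ , _ = meetsPath (zero , r₁∈) F₋ F₊
          (0 , (λ { zero _ → inj₂ refl ; (suc l) e → ⊥-elim (true≢false (trans (sym e) (none l))) }) ,
               (λ _ → inj₁ refl) , (λ e → ⊥-elim (∌η (r₁∈ , e))))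
      to τ (meetsPath (l , l∈) _ F₊ (p , onNew , onR₁ , onT)) =
        meetsPath (suc l , l∈) (face-cong X (λ v → minus-absorbs (xIn τ v) (v =ᵇ t) (v =ᵇ s)) F₋')
                               (face-cong X (λ v → plus-absorbs (xIn τ v) (v =ᵇ t) (v =ᵇ s)) F₊')
          (suc p , (λ { zero e → InPair-suc (onR₁ e) ; (suc l') e → InPair-suc (onNew l' e) }) ,
                   (λ e → ⊥-elim (true≢false (trans (sym e) s∉))) , (λ e → InPair-suc (onT e)))
        where
        split = subFace-new⇒ (withT τ) (retype (∨-zeroʳ (r₁In τ)) F₊)
        F₋' = proj₁ split
        F₊' = proj₁ (proj₂ split)
        s∉ : xIn τ s ≡ false
        s∉ = ¬-not λ e → proj₂ (proj₂ split) (cong (_∨ (s =ᵇ t)) e , trans (cong (xIn τ t ∨_) (=ᵇ-refl t)) (∨-zeroʳ _))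

      -- A face through some r_{l+2}: it avoids s, and shifts down along the path.
      from-later : ∀ τ l → lookup τ (newV K {suc (N X)} l) ≡ true →
        Face X (tabulate (λ v → xIn τ v ∧ not (inEdge s t v))) → Face X (tabulate (λ v → xIn τ v ∨ inEdge s t v)) →
        ∀ p → ExplicitSubdivision.PathWithin (suc K) X s t τ p → KFace K Y zero (suc t) τ
      from-later τ l l∈ F₋ F₊ p (onNew , onS , onT) = meetsPath (l , l∈) F₋Y F₊Y (shiftDown p refl)
        where
        -- s and r_{l+2} are too far apart on the path
        s∉ : xIn τ s ≡ false
        s∉ = ¬-not λ e → InPair-far 0 (toℕ l) (onS e) (onNew (suc l) l∈)
        minusEdge : ∀ v → (xIn τ v ∧ not (inEdge s t v)) ≡ withoutT τ v
        minusEdge v with v Fin.≟ s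
        ... | yes refl rewrite s∉ = refl
        ... | no _ = refl
        F₋Y : Face Y ((r₁In τ ∧ false) ∷ tabulate (withoutT τ))
        F₋Y = retype (sym (∧-zeroʳ (r₁In τ))) (subFace-old⇐ (withoutT τ) (face-cong X minusEdge F₋)
                (λ (_ , e) → true≢false (trans (sym e) (trans (cong (λ z → xIn τ t ∧ not z) (=ᵇ-refl t)) (∧-zeroʳ _)))))
        F₊Y : Face Y ((r₁In τ ∨ true) ∷ tabulate (withT τ))
        F₊Y = retype (sym (∨-zeroʳ (r₁In τ))) (subFace-new⇐ (withT τ)
                (face-cong X (λ v → sym (minus-absorbs (xIn τ v) (v =ᵇ t) (v =ᵇ s))) F₋)
                (face-cong X (λ v → sym (plus-absorbs (xIn τ v) (v =ᵇ t) (v =ᵇ s))) F₊)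
                (λ (e , _) → true≢false (trans (sym e) (trans (cong (_∨ (s =ᵇ t)) s∉) (=ᵇ-false s≢t)))))
        shiftDown : ∀ q → q ≡ p → Σ ℕ (ExplicitSubdivision.PathWithin K Y zero (suc t) τ)
        shiftDown zero refl with onNew (suc l) l∈
        ... | inj₁ ()
        ... | inj₂ ()
        shiftDown (suc p') refl = p' , (λ l' e → InPair-pred (onNew (suc l') e)) , atR₁ , (λ e → InPair-pred (onT e))
          where
          atR₁ : r₁In τ ≡ true → InPair p' 0
          atR₁ e with onNew zero e
          ... | inj₁ refl = inj₁ refl
          ... | inj₂ ()

      -- A face whose only new vertex is r₁: it avoids t, and is a face of Y
      -- through its new vertex r₁ but avoiding the later path.
      from-r₁ : ∀ τ → (∀ l → lookup τ (newV K {suc (N X)} l) ≡ false) → r₁In τ ≡ true →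
        Face X (tabulate (λ v → xIn τ v ∧ not (inEdge s t v))) → Face X (tabulate (λ v → xIn τ v ∨ inEdge s t v)) →
        ∀ p → ExplicitSubdivision.PathWithin (suc K) X s t τ p → KFace K Y zero (suc t) τ
      from-r₁ τ none r₁∈ F₋ F₊ p (onNew , _ , onT) =
        avoidsPath none (retype (sym r₁∈) (subFace-new⇐ (xIn τ) F₋ F₊ (λ (_ , e) → t∉ e))) (λ (_ , e) → t∉ e)
        where
        -- r₁ and t are too far apart on the path
        t∉ : xIn τ t ≢ true
        t∉ e = InPair-far 1 k (onNew zero r₁∈) (onT e)

      from : ∀ τ → KFace (suc K) X s t τ → KFace K Y zero (suc t) τ
      from τ (avoidsPath none F ∌η) =
        avoidsPath (λ l → none (suc l)) (retype (sym (none zero)) (subFace-old⇐ (xIn τ) F ∌η))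
                   (λ (e , _) → true≢false (trans (sym e) (none zero)))
      from τ (meetsPath (l , l∈) F₋ F₊ (p , within))
        with any? (λ l' → lookup τ (newV K {suc (N X)} l') Data.Bool.≟ true)
      ... | yes (l' , l'∈) = from-later τ l' l'∈ F₋ F₊ p within
      ... | no noLater = from-r₁ τ none (onlyR₁ l l∈) F₋ F₊ p within
        where
        none : ∀ l' → lookup τ (newV K {suc (N X)} l') ≡ false
        none l' = ¬-not λ e → noLater (l' , e)
        onlyR₁ : ∀ l → newIn (suc K) X s t τ l ≡ true → r₁In τ ≡ true
        onlyR₁ zero     e = e
        onlyR₁ (suc l') e = ⊥-elim (true≢false (trans (sym e) (none l')))

      step : E K Y zero (suc t) ≅ E (suc K) X s t
      step = ≅-sameVertices (E K Y zero (suc t)) (KFace (suc K) X s t) to from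

  subK≅E : ∀ k (X : SC) (s t : Fin (N X)) → s ≢ t → SubK (suc k) X s t ≅ E (suc k) X s t
  subK≅E zero    X s t s≢t = IteratedSubdivision.base X s t s≢t
  subK≅E (suc k) X s t s≢t =
    ≅-trans (subK≅E k (Sub X s t) zero (suc t) (λ ())) (IteratedSubdivision.Step.step X s t s≢t k)

module Words where

  open Preliminaries
  open import Data.Nat using (ℕ; zero; suc; _+_; _≤_; s≤s; z≤n)
  open import Data.Nat.Properties using (≤-trans; ≤-reflexive; ≤-antisym; n≤1+n; <-irrefl; suc-injective)
  open import Data.Bool using (Bool; true; false)
  open import Data.Bool.Properties using (¬-not)
  open import Data.Fin as Fin using (Fin; zero; suc; toℕ)
  open import Data.Vec as Vec using (Vec; []; _∷_; lookup; toList)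
  open import Data.Vec.Properties using (length-toList)
  open import Data.List as List using (List; []; _∷_; _++_; length; reverse; [_])
  open import Data.List.Properties using (++-assoc; ++-identityʳ; unfold-reverse; length-++)
  open import Data.List.Relation.Binary.Sublist.Propositional using ([]; _∷_; _∷ʳ_) renaming (_⊆_ to _⊑_; ⊆-refl to ⊑-refl; ⊆-trans to ⊑-trans)
  open import Data.List.Relation.Binary.Sublist.Propositional.Properties using (length-mono-≤; []⊆-universal)
  open import Data.List.Relation.Binary.Sublist.Heterogeneous.Properties using (toPointwise)
  open import Data.List.Relation.Binary.Pointwise using (Pointwise-≡⇒≡)
  open import Data.List.Relation.Unary.All using (All; []; _∷_)
  import Data.List.Relation.Unary.All
  open import Data.Product using (Σ; _×_; _,_; proj₁; proj₂)
  open import Data.Sum using (_⊎_; inj₁; inj₂)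
  import Data.Sum
  open import Data.Unit using (⊤; tt)
  open import Relation.Binary.PropositionalEquality hiding ([_])
  open import Data.Empty using (⊥; ⊥-elim)
  open import Function using (_∘_)

  ⊑-++-split : ∀ {A : Set} (P M : List A) {v : List A} → v ⊑ (P ++ M) →
    Σ (List A) λ v₁ → Σ (List A) λ v₂ → (v ≡ v₁ ++ v₂) × (v₁ ⊑ P) × (v₂ ⊑ M)
  ⊑-++-split []      M p = [] , _ , refl , [] , p
  ⊑-++-split (x ∷ P) M (.x ∷ʳ p) with ⊑-++-split P M p
  ... | v₁ , v₂ , refl , p₁ , p₂ = v₁ , v₂ , refl , x ∷ʳ p₁ , p₂
  ⊑-++-split (x ∷ P) M (refl ∷ p) with ⊑-++-split P M p
  ... | v₁ , v₂ , refl , p₁ , p₂ = x ∷ v₁ , v₂ , refl , refl ∷ p₁ , p₂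

  ⊑-long⇒≡ : ∀ {A : Set} {xs ys : List A} → xs ⊑ ys → length ys ≤ length xs → xs ≡ ys
  ⊑-long⇒≡ p le = Pointwise-≡⇒≡ (toPointwise (≤-antisym (length-mono-≤ p) le) p)

  keep-++ : ∀ {A : Set} {a b} (xs : Vec A a) (ys : Vec A b) (σ : Vec Bool a) (τ : Vec Bool b) →
    keep (xs Vec.++ ys) (σ Vec.++ τ) ≡ keep xs σ ++ keep ys τ
  keep-++ []       ys []          τ = refl
  keep-++ (x ∷ xs) ys (true ∷ σ)  τ = cong (x ∷_) (keep-++ xs ys σ τ)
  keep-++ (x ∷ xs) ys (false ∷ σ) τ = keep-++ xs ys σ τ

  keep-⊑ : ∀ {A : Set} {a} (xs : Vec A a) (σ : Vec Bool a) → keep xs σ ⊑ toList xs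
  keep-⊑ []       []          = []
  keep-⊑ (x ∷ xs) (true ∷ σ)  = refl ∷ keep-⊑ xs σ
  keep-⊑ (x ∷ xs) (false ∷ σ) = x ∷ʳ keep-⊑ xs σ

  keep-length : ∀ {A : Set} {a} (xs : Vec A a) (σ : Vec Bool a) → length (keep xs σ) ≤ a
  keep-length xs σ = ≤-trans (length-mono-≤ (keep-⊑ xs σ)) (≤-reflexive (length-toList xs))

  keep-all : ∀ {A : Set} {a} (xs : Vec A a) (σ : Vec Bool a) → (∀ q → lookup σ q ≡ true) → keep xs σ ≡ toList xs
  keep-all []       []          _ = refl
  keep-all (x ∷ xs) (true ∷ σ)  h = cong (x ∷_) (keep-all xs σ (λ q → h (suc q)))
  keep-all (x ∷ xs) (false ∷ σ) h with h zero
  ... | ()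

  keep-long⇒all : ∀ {A : Set} {a} (xs : Vec A a) (σ : Vec Bool a) → a ≤ length (keep xs σ) → ∀ q → lookup σ q ≡ true
  keep-long⇒all (x ∷ xs) (true ∷ σ)  (s≤s le) zero    = refl
  keep-long⇒all (x ∷ xs) (true ∷ σ)  (s≤s le) (suc q) = keep-long⇒all xs σ le q
  keep-long⇒all (x ∷ xs) (false ∷ σ) le       q       = ⊥-elim (<-irrefl refl (≤-trans le (keep-length xs σ)))

  ⊑-keep-long : ∀ {A : Set} {a} (xs : Vec A a) (σ : Vec Bool a) {u : List A} → u ⊑ keep xs σ → a ≤ length u →
    (∀ q → lookup σ q ≡ true) × (u ≡ toList xs)
  ⊑-keep-long xs σ u⊑ le =
    keep-long⇒all xs σ (≤-trans le (length-mono-≤ u⊑)) ,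
    ⊑-long⇒≡ (⊑-trans u⊑ (keep-⊑ xs σ)) (≤-trans (≤-reflexive (length-toList xs)) le)

  altL : ∀ {n} → Fin n → Fin n → ℕ → Word n
  altL x y k = toList (alt x y k)

  length-altL : ∀ {n} (x y : Fin n) k → length (altL x y k) ≡ k
  length-altL x y zero    = refl
  length-altL x y (suc k) = cong suc (length-altL y x k)

  pow2-snoc : ∀ {n} (x y : Fin n) k → pow2 y x k ++ [ y ] ≡ y ∷ pow2 x y k
  pow2-snoc x y zero    = refl
  pow2-snoc x y (suc k) = cong (λ w → y ∷ x ∷ w) (pow2-snoc x y k)

  alt-reverse-alt : ∀ {n} (x y : Fin n) k → altL x y k ++ reverse (altL y x k) ≡ pow2 x y k
  alt-reverse-alt x y zero    = refl
  alt-reverse-alt x y (suc k) = begin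
    x ∷ (altL y x k ++ reverse (y ∷ altL x y k))       ≡⟨ cong (λ w → x ∷ (altL y x k ++ w)) (unfold-reverse y (altL x y k)) ⟩
    x ∷ (altL y x k ++ (reverse (altL x y k) ++ [ y ])) ≡⟨ cong (x ∷_) (sym (++-assoc (altL y x k) _ _)) ⟩
    x ∷ ((altL y x k ++ reverse (altL x y k)) ++ [ y ]) ≡⟨ cong (λ w → x ∷ (w ++ [ y ])) (alt-reverse-alt y x k) ⟩
    x ∷ (pow2 y x k ++ [ y ])                           ≡⟨ cong (x ∷_) (pow2-snoc x y k) ⟩
    x ∷ y ∷ pow2 x y k                                  ∎
    where open ≡-Reasoning

  module CoxeterFacts {n} (C : CoxeterMatrix n) where
    open Coxeter C public
    open CoxeterMatrix C

    ∼-cong : ∀ {u v} (p q : Word n) → u ∼ v → (p ++ u ++ q) ∼ (p ++ v ++ q)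
    ∼-cong p q ∼-refl          = ∼-refl
    ∼-cong p q (∼-sym r)       = ∼-sym (∼-cong p q r)
    ∼-cong p q (∼-trans r s)   = ∼-trans (∼-cong p q r) (∼-cong p q s)
    ∼-cong p q (∼-rel u v i j) =
      subst₂ _∼_ (reassoc (pow2 i j (m i j))) (reassoc []) (∼-rel (p ++ u) (v ++ q) i j)
      where
      reassoc : ∀ w → (p ++ u) ++ (w ++ v ++ q) ≡ p ++ (u ++ w ++ v) ++ q
      reassoc w = begin
        (p ++ u) ++ (w ++ v ++ q)  ≡⟨ ++-assoc p u _ ⟩
        p ++ u ++ w ++ v ++ q      ≡⟨ cong (λ z → p ++ u ++ z) (sym (++-assoc w v q)) ⟩
        p ++ u ++ (w ++ v) ++ q    ≡⟨ cong (p ++_) (sym (++-assoc u _ q)) ⟩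
        p ++ (u ++ w ++ v) ++ q    ∎
        where open ≡-Reasoning

    -- Generators are involutions: s_x s_x = 1 (the relation for m_xx = 1).
    square-cancel : ∀ (p q : Word n) x → (p ++ x ∷ x ∷ q) ∼ (p ++ q)
    square-cancel p q x = subst (λ w → (p ++ w ++ q) ∼ (p ++ q)) squared (∼-rel p q x x)
      where
      squared : pow2 x x (m x x) ≡ x ∷ x ∷ []
      squared rewrite diag x = refl

    reverse-cancel : ∀ (w : Word n) → (reverse w ++ w) ∼ []
    reverse-cancel []      = ∼-refl
    reverse-cancel (x ∷ w) =
      subst (λ z → (z ++ x ∷ w) ∼ []) (sym (unfold-reverse x w))
        (subst (_∼ []) (sym (++-assoc (reverse w) [ x ] (x ∷ w)))
          (∼-trans (square-cancel (reverse w) w x) (reverse-cancel w)))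

    braid-relation : ∀ x y → altL x y (m x y) ∼ altL y x (m x y)
    braid-relation x y = ∼-trans (∼-sym cancelR) (subst (_∼ R) regroup (∼-rel [] R x y))
      where
      L = altL x y (m x y)
      R = altL y x (m x y)
      cancelR : (L ++ reverse R ++ R) ∼ L
      cancelR = subst₂ _∼_ (cong (L ++_) (++-identityʳ _)) (++-identityʳ L) (∼-cong L [] (reverse-cancel R))
      regroup : pow2 x y (m x y) ++ R ≡ L ++ reverse R ++ R
      regroup = trans (cong (_++ R) (sym (alt-reverse-alt x y (m x y)))) (++-assoc L (reverse R) R)

    reduced-resp : ∀ {u v} → u ∼ v → length u ≡ length v → Reduced u → Reduced v
    reduced-resp r e ru w w∼v = subst (_≤ length w) e (ru w (∼-trans w∼v (∼-sym r)))

    reduced-no-square : ∀ (A B : Word n) x → Reduced (A ++ x ∷ x ∷ B) → ⊥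
    reduced-no-square A B x red =
      <-irrefl refl (≤-trans (n≤1+n _) (subst (_≤ length (A ++ B)) (longer A) (red _ (∼-sym (square-cancel A B x)))))
      where
      longer : ∀ A → length (A ++ x ∷ x ∷ B) ≡ suc (suc (length (A ++ B)))
      longer []      = refl
      longer (_ ∷ A) = cong suc (longer A)

  DeletedOnly : ∀ {k} → (ℕ → Set) → Vec Bool k → Set
  DeletedOnly P σ = ∀ q → lookup σ q ≡ false → P (toℕ q)

  module Alternating {n : ℕ} where

    private
      head-≡ : ∀ {p q : Fin n} {r s : Word n} → p ∷ r ≡ q ∷ s → p ≡ q
      head-≡ refl = refl

    alt-prefix : ∀ (x y : Fin n) {ℓ k} → ℓ ≤ k → altL x y ℓ ⊑ altL x y k
    alt-prefix x y {zero}  z≤n      = []⊆-universal _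
    alt-prefix x y {suc ℓ} (s≤s le) = refl ∷ alt-prefix y x le

    full⇒nothing-deleted : ∀ {k} (w : Vec (Fin n) k) σ {u : Word n} → u ⊑ keep w σ → k ≤ length u →
      DeletedOnly (λ _ → ⊥) σ
    full⇒nothing-deleted w σ u⊑ le q e with trans (sym (proj₁ (⊑-keep-long w σ u⊑ le) q)) e
    ... | ()

    wrong-start : ∀ {x y : Fin n} → x ≢ y → ∀ k σ (u : Word n) → (x ∷ u) ⊑ keep (alt y x (suc k)) σ → length u ≡ k → ⊥
    wrong-start {x} {y} ne k σ u p e = ne (head-≡ (proj₂ (⊑-keep-long (alt y x (suc k)) σ p (≤-reflexive (cong suc (sym e))))))

    prefix⇒last-deleted : ∀ (x y : Fin n) → x ≢ y → ∀ k σ → altL x y k ⊑ keep (alt x y (suc k)) σ →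
      DeletedOnly (_≡ k) σ
    prefix⇒last-deleted x y ne zero    σ           p          zero    e  = refl
    prefix⇒last-deleted x y ne (suc k) (true ∷ σ)  (refl ∷ p) (suc q) e  = cong suc (prefix⇒last-deleted y x (ne ∘ sym) k σ p q e)
    prefix⇒last-deleted x y ne (suc k) (true ∷ σ)  (.x ∷ʳ p)  q       e  = ⊥-elim (wrong-start ne k σ _ p (length-altL y x k))
    prefix⇒last-deleted x y ne (suc k) (false ∷ σ) p          q       e  = ⊥-elim (wrong-start ne k σ _ p (length-altL y x k))

    suffix⇒first-deleted : ∀ (x y : Fin n) → x ≢ y → ∀ k σ → altL y x k ⊑ keep (alt x y (suc k)) σ →
      DeletedOnly (_≡ 0) σ
    suffix⇒first-deleted x y ne k       σ           p         zero    e = refl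
    suffix⇒first-deleted x y ne (suc k) (true ∷ σ)  (y≡x ∷ p) (suc q) e = ⊥-elim (ne (sym y≡x))
    suffix⇒first-deleted x y ne (suc k) (true ∷ σ)  (.x ∷ʳ p) (suc q) e =
      ⊥-elim (full⇒nothing-deleted (alt y x (suc k)) σ p (≤-reflexive (sym (length-altL y x (suc k)))) q e)
    suffix⇒first-deleted x y ne (suc k) (false ∷ σ) p         (suc q) e =
      ⊥-elim (full⇒nothing-deleted (alt y x (suc k)) σ p (≤-reflexive (sym (length-altL y x (suc k)))) q e)

    prefix⇒adjacent-deleted : ∀ (x y : Fin n) → x ≢ y → ∀ k σ → altL x y k ⊑ keep (alt x y (suc (suc k))) σ →
      Σ ℕ λ c → DeletedOnly (InPair c) σ
    prefix⇒adjacent-deleted x y ne zero σ p = 0 , λ { zero _ → inj₁ refl ; (suc zero) _ → inj₂ refl }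
    prefix⇒adjacent-deleted x y ne (suc k) (true ∷ σ) (refl ∷ p) with prefix⇒adjacent-deleted y x (ne ∘ sym) k σ p
    ... | c , h = suc c , λ { (suc q) e → Data.Sum.map (cong suc) (cong suc) (h q e) }
    prefix⇒adjacent-deleted x y ne (suc k) (true ∷ σ) (.x ∷ʳ p) =
      0 , λ { zero _ → inj₁ refl ; (suc q) e → inj₂ (cong suc (suffix⇒first-deleted y x (ne ∘ sym) (suc k) σ p q e)) }
    prefix⇒adjacent-deleted x y ne (suc k) (false ∷ σ) p =
      0 , λ { zero _ → inj₁ refl ; (suc q) e → inj₂ (cong suc (suffix⇒first-deleted y x (ne ∘ sym) (suc k) σ p q e)) }

    suffix⇒ends-deleted : ∀ (x y : Fin n) → x ≢ y → ∀ k σ → altL y x k ⊑ keep (alt x y (suc (suc k))) σ →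
      DeletedOnly (λ z → (z ≡ 0) ⊎ (z ≡ suc k)) σ
    suffix⇒ends-deleted x y ne k       σ           p         zero          e = inj₁ refl
    suffix⇒ends-deleted x y ne zero    σ           p         (suc zero)    e = inj₂ refl
    suffix⇒ends-deleted x y ne (suc k) (true ∷ σ)  (y≡x ∷ p) (suc q)       e = ⊥-elim (ne (sym y≡x))
    suffix⇒ends-deleted x y ne (suc k) (true ∷ σ)  (.x ∷ʳ p) (suc q)       e = inj₂ (cong suc (prefix⇒last-deleted y x (ne ∘ sym) (suc k) σ p q e))
    suffix⇒ends-deleted x y ne (suc k) (false ∷ σ) p         (suc q)       e = inj₂ (cong suc (prefix⇒last-deleted y x (ne ∘ sym) (suc k) σ p q e))

    private
      skip-head : ∀ {k} (z : Fin n) b (w : Vec (Fin n) k) σ {u : Word n} → u ⊑ keep w σ → u ⊑ keep (z ∷ w) (b ∷ σ)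
      skip-head z true  w σ p = z ∷ʳ p
      skip-head z false w σ p = p

      suc≢0 : ∀ {a} → suc a ≡ 0 → ⊥
      suc≢0 ()

    nothing-deleted⇒whole : ∀ (x y : Fin n) k σ → DeletedOnly (λ _ → ⊥) σ → altL x y k ⊑ keep (alt x y k) σ
    nothing-deleted⇒whole x y k σ h = subst (altL x y k ⊑_) (sym (keep-all (alt x y k) σ (λ q → ¬-not (h q)))) ⊑-refl

    last-deleted⇒prefix : ∀ (x y : Fin n) k σ → DeletedOnly (_≡ k) σ → altL x y k ⊑ keep (alt x y (suc k)) σ
    last-deleted⇒prefix x y zero    σ           h = []⊆-universal _
    last-deleted⇒prefix x y (suc k) (true ∷ σ)  h = refl ∷ last-deleted⇒prefix y x k σ (λ q e → suc-injective (h (suc q) e))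
    last-deleted⇒prefix x y (suc k) (false ∷ σ) h with h zero refl
    ... | ()

    first-deleted⇒suffix : ∀ (x y : Fin n) k σ → DeletedOnly (_≡ 0) σ → altL y x k ⊑ keep (alt x y (suc k)) σ
    first-deleted⇒suffix x y k (b ∷ σ) h =
      skip-head x b (alt y x k) σ (nothing-deleted⇒whole y x k σ (λ q e → suc≢0 (h (suc q) e)))

    adjacent-deleted⇒prefix : ∀ (x y : Fin n) k σ c → DeletedOnly (InPair c) σ → altL x y k ⊑ keep (alt x y (suc (suc k))) σ
    adjacent-deleted⇒prefix x y k (b₀ ∷ b₁ ∷ σ) zero h =
      skip-head x b₀ _ _ (skip-head y b₁ _ _ (nothing-deleted⇒whole x y k σ (λ q e → never (h (suc (suc q)) e))))
      where
      never : ∀ {a} → InPair 0 (suc (suc a)) → ⊥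
      never (inj₁ ())
      never (inj₂ ())
    adjacent-deleted⇒prefix x y zero    σ           (suc c) h = []⊆-universal _
    adjacent-deleted⇒prefix x y (suc k) (true ∷ σ)  (suc c) h =
      refl ∷ adjacent-deleted⇒prefix y x k σ c (λ q e → Data.Sum.map suc-injective suc-injective (h (suc q) e))
    adjacent-deleted⇒prefix x y (suc k) (false ∷ σ) (suc c) h with h zero refl
    ... | inj₁ ()
    ... | inj₂ ()

    ends-deleted⇒suffix : ∀ (x y : Fin n) k σ → DeletedOnly (λ z → (z ≡ 0) ⊎ (z ≡ suc k)) σ →
      altL y x k ⊑ keep (alt x y (suc (suc k))) σ
    ends-deleted⇒suffix x y k (b ∷ σ) h = skip-head x b _ σ (last-deleted⇒prefix y x k σ (λ q e → last (h (suc q) e)))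
      where
      last : ∀ {a} → (suc a ≡ 0) ⊎ (suc a ≡ suc k) → a ≡ k
      last (inj₂ e) = suc-injective e

    OneOf : Fin n → Fin n → Fin n → Set
    OneOf x y z = (z ≡ x) ⊎ (z ≡ y)

    NoSquare : Word n → Set
    NoSquare []            = ⊤
    NoSquare (x ∷ [])      = ⊤
    NoSquare (x ∷ y ∷ r)   = x ≢ y × NoSquare (y ∷ r)

    alt-letters : ∀ (x y : Fin n) k → All (OneOf x y) (altL x y k)
    alt-letters x y zero    = []
    alt-letters x y (suc k) = inj₁ refl ∷ Data.List.Relation.Unary.All.map Data.Sum.swap (alt-letters y x k)

    noSquare⇒alternating : ∀ (x y : Fin n) (u : Word n) → All (OneOf x y) u → NoSquare u →
      (u ≡ altL x y (length u)) ⊎ (u ≡ altL y x (length u))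
    noSquare⇒alternating x y []          _              _         = inj₁ refl
    noSquare⇒alternating x y (z ∷ [])    (inj₁ refl ∷ []) _       = inj₁ refl
    noSquare⇒alternating x y (z ∷ [])    (inj₂ refl ∷ []) _       = inj₂ refl
    noSquare⇒alternating x y (z ∷ w ∷ u) (z∈ ∷ rest) (z≢w , ns) with noSquare⇒alternating x y (w ∷ u) rest ns | z∈
    ... | inj₁ e | inj₁ refl = ⊥-elim (z≢w (sym (head-≡ e)))
    ... | inj₁ e | inj₂ refl = inj₂ (cong (z ∷_) e)
    ... | inj₂ e | inj₁ refl = inj₁ (cong (z ∷_) e)
    ... | inj₂ e | inj₂ refl = ⊥-elim (z≢w (sym (head-≡ e)))

  length-sandwich : ∀ {A : Set} (v₁ v₃ : List A) {u u' : List A} → length u ≡ length u' →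
    length (v₁ ++ u ++ v₃) ≡ length (v₁ ++ u' ++ v₃)
  length-sandwich []       v₃ {u} {u'} e = trans (length-++ u) (trans (cong (_+ length v₃) e) (sym (length-++ u')))
  length-sandwich (_ ∷ v₁) v₃ e = cong suc (length-sandwich v₁ v₃ e)

  module _ {n} (C : CoxeterMatrix n) where
    open CoxeterFacts C
    open Alternating {n}

    reduced⇒noSquare : ∀ (A B u : Word n) → Reduced (A ++ u ++ B) → NoSquare u
    reduced⇒noSquare A B []          r = tt
    reduced⇒noSquare A B (x ∷ [])    r = tt
    reduced⇒noSquare A B (x ∷ y ∷ u) r =
      (λ { refl → reduced-no-square A (u ++ B) x r }) ,
      reduced⇒noSquare (A ++ x ∷ []) B (y ∷ u) (subst Reduced (sym (++-assoc A (x ∷ []) _)) r)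

module BraidMoves where

  open Preliminaries
  open SimplicialComplexes
  open Words
  open import Data.Nat using (ℕ; zero; suc; _+_; _≤_; _<_; _∸_; s≤s; z≤n)
  open import Data.Nat.Properties using (≤-trans; ≤-reflexive; ≤-refl; ≤-pred; suc-injective; 1+n≰n)
  open import Data.Bool using (Bool; true; false; _∧_; _∨_; not)
  import Data.Bool
  import Data.Bool.Properties as BP
  open import Data.Bool.Properties using (¬-not; not-injective)
  open import Data.Fin as Fin using (Fin; zero; suc; toℕ; _↑ˡ_; _↑ʳ_; fromℕ; inject₁; opposite)
  open import Data.Fin.Properties using (toℕ-injective; toℕ-fromℕ; toℕ-inject₁; toℕ<n; opposite-prop; opposite-involutive; ↑ˡ-injective; ↑ʳ-injective; any?)
  open import Data.Fin.Subset using (Subset; ∁)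
  open import Data.Vec as Vec using (Vec; tabulate; lookup; toList)
  open import Data.Vec.Properties using (lookup∘tabulate; tabulate-cong; lookup-++ˡ; lookup-++ʳ; lookup-map; map-++; toList-++)
  open import Data.List as List using (_++_; length)
  open import Data.List.Relation.Binary.Sublist.Propositional using () renaming (_⊆_ to _⊑_; ⊆-trans to ⊑-trans)
  open import Data.List.Relation.Binary.Sublist.Propositional.Properties using (length-mono-≤; ++⁺; All-resp-⊆)
  open import Data.Product using (Σ; _×_; _,_; proj₁; proj₂)
  open import Data.Sum using (_⊎_; inj₁; inj₂)
  import Data.Sum
  open import Relation.Nullary using (¬_; yes; no)
  open import Relation.Nullary.Decidable using (⌊_⌋)
  open import Relation.Binary.PropositionalEquality hiding ([_])
  open import Data.Empty using (⊥; ⊥-elim)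
  open import Function using (_∘_)

  open ExplicitSubdivision using (E; KFace; avoidsPath; meetsPath)

  module BraidFactor {n} (C : CoxeterMatrix n) {a b : ℕ} (Q : Vec (Fin n) a) (Q' : Vec (Fin n) b) (π : Word n) (m' : ℕ) where
    open CoxeterFacts C
    open Alternating {n}

    m M : ℕ
    m = suc (suc (suc (suc m')))
    M = suc (suc (suc m'))

    NN : ℕ
    NN = a + (m + b)

    inQ : Fin a → Fin NN
    inQ q = q ↑ˡ (m + b)
    inW : Fin m → Fin NN
    inW p = a ↑ʳ (p ↑ˡ b)
    inQ' : Fin b → Fin NN
    inQ' q = a ↑ʳ (m ↑ʳ q)

    firstW lastW : Fin m
    firstW = zero
    lastW  = fromℕ M

    IQ : Subset NN → Subset a
    IQ I = tabulate (lookup I ∘ inQ)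
    IW : Subset NN → Subset m
    IW I = tabulate (lookup I ∘ inW)
    IQ' : Subset NN → Subset b
    IQ' I = tabulate (lookup I ∘ inQ')

    -- the p-th letter of the braid factor is deleted by I
    d : Subset NN → Fin m → Bool
    d I p = lookup I (inW p)

    Δ : Fin n → Fin n → SC
    Δ x y = subwordComplex C (Q Vec.++ alt x y m Vec.++ Q') π

    CompletesWith : Fin n → Fin n → ℕ → Subset a → Subset b → Set
    CompletesWith z w ℓ A B = Σ (Word n) λ v₁ → Σ (Word n) λ v₃ →
      (v₁ ⊑ keep Q (∁ A)) × (v₃ ⊑ keep Q' (∁ B)) ×
      Reduced (v₁ ++ altL z w ℓ ++ v₃) × ((v₁ ++ altL z w ℓ ++ v₃) ∼ π)

    Completes : Fin n → Fin n → ℕ → Subset NN → Set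
    Completes z w ℓ I = CompletesWith z w ℓ (IQ I) (IQ' I)

    completes-resp : ∀ {z w ℓ} (I J : Subset NN) → (∀ q → lookup I (inQ q) ≡ lookup J (inQ q)) →
      (∀ q → lookup I (inQ' q) ≡ lookup J (inQ' q)) → Completes z w ℓ I → Completes z w ℓ J
    completes-resp {z} {w} {ℓ} I J onQ onQ' =
      subst₂ (CompletesWith z w ℓ) (tabulate-cong onQ) (tabulate-cong onQ')

    split-positions : ∀ I → I ≡ IQ I Vec.++ IW I Vec.++ IQ' I
    split-positions I with Vec.splitAt a I
    ... | ys , zs , refl with Vec.splitAt m zs
    ... | ws , ts , refl = sym (cong₂ Vec._++_ onQ (cong₂ Vec._++_ onW onQ'))
      where
      I₀ = ys Vec.++ ws Vec.++ ts
      onQ : IQ I₀ ≡ ys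
      onQ = subset-ext λ q → trans (lookup∘tabulate (lookup I₀ ∘ inQ) q) (lookup-++ˡ ys (ws Vec.++ ts) q)
      onW : IW I₀ ≡ ws
      onW = subset-ext λ p → trans (lookup∘tabulate (lookup I₀ ∘ inW) p) (trans (lookup-++ʳ ys (ws Vec.++ ts) (p ↑ˡ b)) (lookup-++ˡ ws ts p))
      onQ' : IQ' I₀ ≡ ts
      onQ' = subset-ext λ q → trans (lookup∘tabulate (lookup I₀ ∘ inQ') q) (trans (lookup-++ʳ ys (ws Vec.++ ts) (m ↑ʳ q)) (lookup-++ʳ ws ts q))

    keep-split : ∀ (W : Vec (Fin n) m) I →
      keep (Q Vec.++ W Vec.++ Q') (∁ I) ≡ keep Q (∁ (IQ I)) ++ keep W (∁ (IW I)) ++ keep Q' (∁ (IQ' I))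
    keep-split W I = begin
      keep (Q Vec.++ W Vec.++ Q') (∁ I)
        ≡⟨ cong (keep (Q Vec.++ W Vec.++ Q') ∘ ∁) (split-positions I) ⟩
      keep (Q Vec.++ W Vec.++ Q') (∁ (IQ I Vec.++ IW I Vec.++ IQ' I))
        ≡⟨ cong (keep (Q Vec.++ W Vec.++ Q')) (trans (map-++ not (IQ I) _) (cong (∁ (IQ I) Vec.++_) (map-++ not (IW I) _))) ⟩
      keep (Q Vec.++ W Vec.++ Q') (∁ (IQ I) Vec.++ ∁ (IW I) Vec.++ ∁ (IQ' I))
        ≡⟨ keep-++ Q (W Vec.++ Q') (∁ (IQ I)) _ ⟩
      keep Q (∁ (IQ I)) ++ keep (W Vec.++ Q') (∁ (IW I) Vec.++ ∁ (IQ' I))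
        ≡⟨ cong (keep Q (∁ (IQ I)) ++_) (keep-++ W Q' (∁ (IW I)) (∁ (IQ' I))) ⟩
      keep Q (∁ (IQ I)) ++ keep W (∁ (IW I)) ++ keep Q' (∁ (IQ' I)) ∎
      where open ≡-Reasoning

    BraidDeleted : (ℕ → Set) → Subset NN → Set
    BraidDeleted P I = ∀ p → d I p ≡ true → P (toℕ p)

    complement-IW : ∀ I p → lookup (∁ (IW I)) p ≡ not (d I p)
    complement-IW I p = trans (lookup-map p not (IW I)) (cong not (lookup∘tabulate (lookup I ∘ inW) p))

    braidDeleted : ∀ P I → DeletedOnly P (∁ (IW I)) → BraidDeleted P I
    braidDeleted P I h p e = h p (trans (complement-IW I p) (cong not e))

    deletedOnly : ∀ P I → BraidDeleted P I → DeletedOnly P (∁ (IW I))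
    deletedOnly P I h p e = h p (not-injective (trans (sym (complement-IW I p)) e))

    Ends : ℕ → Set
    Ends z = (z ≡ 0) ⊎ (z ≡ M)

    -- The five possible shapes of a face of Δ(Q·(s_x s_y ⋯)·Q'; π) when
    -- neither Q·w·Q' with w alternating of length m-3 contains a reduced
    -- expression of π: what is deleted from the braid factor, and which
    -- alternating word the remaining letters contribute.
    data Shape (x y : Fin n) (I : Subset NN) : Set where
      untouched  : BraidDeleted (λ _ → ⊥) I → Completes x y m I → Shape x y I
      lastOut    : BraidDeleted (_≡ M) I → Completes x y M I → Shape x y I
      firstOut   : BraidDeleted (_≡ 0) I → Completes y x M I → Shape x y I
      pairOut    : ∀ c → BraidDeleted (InPair c) I → Completes x y (m ∸ 2) I → Shape x y I
      endsOut    : BraidDeleted Ends I → Completes y x (m ∸ 2) I → Shape x y I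

    completes⇒contains : ∀ z w {ℓ ℓ'} I → ℓ ≤ ℓ' → Completes z w ℓ I → ContainsRed (toList (Q Vec.++ alt z w ℓ' Vec.++ Q')) π
    completes⇒contains z w {ℓ' = ℓ'} I le (v₁ , v₃ , p₁ , p₃ , red , v∼π) =
      _ , subst (_ ⊑_) (sym (trans (toList-++ Q _) (cong (toList Q ++_) (toList-++ (alt z w ℓ') Q'))))
            (++⁺ (⊑-trans p₁ (keep-⊑ Q _)) (++⁺ (alt-prefix z w le) (⊑-trans p₃ (keep-⊑ Q' _)))) ,
      red , v∼π

    module Faces (x y : Fin n) (x≢y : x ≢ y) (br : altL x y m ∼ altL y x m)
      (A₃ : ¬ ContainsRed (toList (Q Vec.++ alt x y (suc m') Vec.++ Q')) π)
      (B₃ : ¬ ContainsRed (toList (Q Vec.++ alt y x (suc m') Vec.++ Q')) π) where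

      KW : Subset NN → Word n
      KW I = keep (alt x y m) (∁ (IW I))

      completes-swap : ∀ I → Completes y x m I → Completes x y m I
      completes-swap I (v₁ , v₃ , p₁ , p₃ , red , v∼π) =
        v₁ , v₃ , p₁ , p₃ , reduced-resp (∼-cong v₁ v₃ (∼-sym br)) sameLength red , ∼-trans (∼-cong v₁ v₃ br) v∼π
        where
        sameLength : length (v₁ ++ altL y x m ++ v₃) ≡ length (v₁ ++ altL x y m ++ v₃)
        sameLength = length-sandwich v₁ v₃ (trans (length-altL y x m) (sym (length-altL x y m)))

      KeptAlternating : Subset NN → Set
      KeptAlternating I = Σ ℕ λ ℓ → ℓ ≤ m ×
        ((altL x y ℓ ⊑ KW I × Completes x y ℓ I) ⊎ (altL y x ℓ ⊑ KW I × Completes y x ℓ I))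

      face⇒keptAlternating : ∀ I → Face (Δ x y) I → KeptAlternating I
      face⇒keptAlternating I (v , v⊑ , red , v∼π)
        with ⊑-++-split (keep Q (∁ (IQ I))) _ (subst (v ⊑_) (keep-split (alt x y m) I) v⊑)
      ... | v₁ , v₂₃ , refl , p₁ , q with ⊑-++-split (KW I) (keep Q' (∁ (IQ' I))) q
      ... | u , v₃ , refl , u⊑ , p₃ =
        length u , lengthBound , Data.Sum.map (as-alternating x y) (as-alternating y x) alternating
        where
        lengthBound : length u ≤ m
        lengthBound = ≤-trans (length-mono-≤ u⊑) (keep-length (alt x y m) (∁ (IW I)))
        alternating : (u ≡ altL x y (length u)) ⊎ (u ≡ altL y x (length u))
        alternating = noSquare⇒alternating x y u
          (All-resp-⊆ (⊑-trans u⊑ (keep-⊑ (alt x y m) (∁ (IW I)))) (alt-letters x y m))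
          (reduced⇒noSquare C v₁ v₃ u red)
        as-alternating : ∀ z w → u ≡ altL z w (length u) → altL z w (length u) ⊑ KW I × Completes z w (length u) I
        as-alternating z w e = subst (_⊑ KW I) e u⊑ ,
          (v₁ , v₃ , p₁ , p₃ , subst (λ t → Reduced (v₁ ++ t ++ v₃)) e red , subst (λ t → (v₁ ++ t ++ v₃) ∼ π) e v∼π)

      -- Hypotheses (A₃), (B₃) leave only alternating words of length m-2, m-1, m.
      shapeOf : ∀ I {ℓ} → NearTop (suc m') ℓ →
        (altL x y ℓ ⊑ KW I × Completes x y ℓ I) ⊎ (altL y x ℓ ⊑ KW I × Completes y x ℓ I) → Shape x y I
      shapeOf I (below le) (inj₁ (_ , c)) = ⊥-elim (A₃ (completes⇒contains x y I le c))
      shapeOf I (below le) (inj₂ (_ , c)) = ⊥-elim (B₃ (completes⇒contains y x I le c))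
      shapeOf I top-2 (inj₁ (s , c)) with prefix⇒adjacent-deleted x y x≢y (suc (suc m')) (∁ (IW I)) s
      ... | k , h = pairOut k (braidDeleted (InPair k) I h) c
      shapeOf I top-2 (inj₂ (s , c)) = endsOut (braidDeleted Ends I (suffix⇒ends-deleted x y x≢y (suc (suc m')) (∁ (IW I)) s)) c
      shapeOf I top-1 (inj₁ (s , c)) = lastOut (braidDeleted (_≡ M) I (prefix⇒last-deleted x y x≢y M (∁ (IW I)) s)) c
      shapeOf I top-1 (inj₂ (s , c)) = firstOut (braidDeleted (_≡ 0) I (suffix⇒first-deleted x y x≢y M (∁ (IW I)) s)) c
      shapeOf I top   (inj₁ (s , c)) =
        untouched (braidDeleted (λ _ → ⊥) I (full⇒nothing-deleted (alt x y m) (∁ (IW I)) s (≤-reflexive (sym (length-altL x y m))))) c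
      shapeOf I top   (inj₂ (s , c)) =
        untouched (braidDeleted (λ _ → ⊥) I (full⇒nothing-deleted (alt x y m) (∁ (IW I)) s (≤-reflexive (sym (length-altL y x m)))))
                  (completes-swap I c)

      face⇒shape : ∀ I → Face (Δ x y) I → Shape x y I
      face⇒shape I F with face⇒keptAlternating I F
      ... | ℓ , le , kept = shapeOf I (nearTop (suc m') ℓ le) kept

      keptAlternating⇒face : ∀ I {z w ℓ} → altL z w ℓ ⊑ KW I → Completes z w ℓ I → Face (Δ x y) I
      keptAlternating⇒face I s (v₁ , v₃ , p₁ , p₃ , red , v∼π) =
        _ , subst (_ ⊑_) (sym (keep-split (alt x y m) I)) (++⁺ p₁ (++⁺ s p₃)) , red , v∼π

      shape⇒face : ∀ I → Shape x y I → Face (Δ x y) I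
      shape⇒face I (untouched h c) = keptAlternating⇒face I (nothing-deleted⇒whole x y m (∁ (IW I)) (deletedOnly _ I h)) c
      shape⇒face I (lastOut h c)   = keptAlternating⇒face I (last-deleted⇒prefix x y M (∁ (IW I)) (deletedOnly (_≡ M) I h)) c
      shape⇒face I (firstOut h c)  = keptAlternating⇒face I (first-deleted⇒suffix x y M (∁ (IW I)) (deletedOnly (_≡ 0) I h)) c
      shape⇒face I (pairOut k h c) = keptAlternating⇒face I (adjacent-deleted⇒prefix x y (suc (suc m')) (∁ (IW I)) k (deletedOnly (InPair k) I h)) c
      shape⇒face I (endsOut h c)   = keptAlternating⇒face I (ends-deleted⇒suffix x y (suc (suc m')) (∁ (IW I)) (deletedOnly Ends I h)) c

  -- The involution of the vertices of the (m-2)-fold subdivision of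
  -- Δ(Q·w·Q') along {g₁, g_m} which exchanges the braid positions of w with
  -- the path g₁, r₁, …, r_{m-2}, g_m read backwards, fixing Q and Q'.
  module PathReversal {n} (C : CoxeterMatrix n) {a b : ℕ} (Q : Vec (Fin n) a) (Q' : Vec (Fin n) b) (π : Word n) (m' : ℕ) where
    open BraidFactor C Q Q' π m' public

    k : ℕ
    k = suc (suc m')

    g₁ gₘ : Fin NN
    g₁ = inW firstW
    gₘ = inW lastW

    toℕ-lastW : toℕ lastW ≡ M
    toℕ-lastW = toℕ-fromℕ M

    opposite-first : opposite firstW ≡ lastW
    opposite-first = toℕ-injective (trans (opposite-prop {m} zero) (sym toℕ-lastW))

    opposite-last : opposite lastW ≡ firstW
    opposite-last = trans (cong opposite (sym opposite-first)) (opposite-involutive firstW)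

    data Position : Fin m → Set where
      first : Position firstW
      last  : Position lastW
      inner : ∀ (l : Fin k) → Position (suc (inject₁ l))

    position : ∀ r → Position r
    position zero    = first
    position (suc r) with lastOrInner r
    ... | isLast    = last
    ... | isInner l = inner l

    position-last : position lastW ≡ last
    position-last rewrite lastOrInner-last k = refl

    position-inner : ∀ l → position (suc (inject₁ l)) ≡ inner l
    position-inner l rewrite lastOrInner-inner l = refl

    pathVertex : ∀ {r} → Position r → Fin (k ⊕ NN)
    pathVertex first     = oldV k g₁
    pathVertex last      = oldV k gₘ
    pathVertex (inner l) = newV k l

    pathV : Fin m → Fin (k ⊕ NN)
    pathV r = pathVertex (position r)

    pathV-last : pathV lastW ≡ oldV k gₘ
    pathV-last rewrite position-last = refl

    pathV-inner : ∀ l → pathV (suc (inject₁ l)) ≡ newV k l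
    pathV-inner l rewrite position-inner l = refl

    data Place : Fin NN → Set where
      atQ  : ∀ q → Place (inQ q)
      atW  : ∀ p → Place (inW p)
      atQ' : ∀ q → Place (inQ' q)

    place : ∀ v → Place v
    place v with leftOrRight a (m + b) v
    ... | isLeft q  = atQ q
    ... | isRight r with leftOrRight m b r
    ...   | isLeft p  = atW p
    ...   | isRight q = atQ' q

    place-Q : ∀ q → place (inQ q) ≡ atQ q
    place-Q q rewrite leftOrRight-left a (m + b) q = refl
    place-W : ∀ p → place (inW p) ≡ atW p
    place-W p rewrite leftOrRight-right a (m + b) (p ↑ˡ b) | leftOrRight-left m b p = refl
    place-Q' : ∀ q → place (inQ' q) ≡ atQ' q
    place-Q' q rewrite leftOrRight-right a (m + b) (m ↑ʳ q) | leftOrRight-right m b q = refl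

    φOld : ∀ {v} → Place v → Fin (k ⊕ NN)
    φOld (atQ q)  = oldV k (inQ q)
    φOld (atW p)  = pathV (opposite p)
    φOld (atQ' q) = oldV k (inQ' q)

    φVertex : ∀ {w} → VertexView k NN w → Fin (k ⊕ NN)
    φVertex (isOld v) = φOld (place v)
    φVertex (isNew l) = oldV k (inW (opposite (suc (inject₁ l))))

    φ : Fin (k ⊕ NN) → Fin (k ⊕ NN)
    φ w = φVertex (vertexView k w)

    φ-Q : ∀ q → φ (oldV k (inQ q)) ≡ oldV k (inQ q)
    φ-Q q rewrite vertexView-old k (inQ q) | place-Q q = refl
    φ-Q' : ∀ q → φ (oldV k (inQ' q)) ≡ oldV k (inQ' q)
    φ-Q' q rewrite vertexView-old k (inQ' q) | place-Q' q = refl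
    φ-W : ∀ p → φ (oldV k (inW p)) ≡ pathV (opposite p)
    φ-W p rewrite vertexView-old k (inW p) | place-W p = refl
    φ-new : ∀ l → φ (newV k l) ≡ oldV k (inW (opposite (suc (inject₁ l))))
    φ-new l rewrite vertexView-new k {NN} l = refl

    φ-pathV : ∀ r → φ (pathV r) ≡ oldV k (inW (opposite r))
    φ-pathV r = onPosition (position r) refl
      where
      onPosition : ∀ (v : Position r) → position r ≡ v → φ (pathV r) ≡ oldV k (inW (opposite r))
      onPosition first     e rewrite e = trans (φ-W firstW) (trans (cong pathV opposite-first) pathV-last)
      onPosition last      e rewrite e = trans (φ-W lastW) (trans (cong pathV opposite-last) (cong (oldV k ∘ inW) (sym opposite-last)))
      onPosition (inner l) e rewrite e = φ-new l

    φ-involutive : ∀ w → φ (φ w) ≡ w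
    φ-involutive w with vertexView k {NN} w
    ... | isNew l = trans (φ-W (opposite (suc (inject₁ l)))) (trans (cong pathV (opposite-involutive (suc (inject₁ l)))) (pathV-inner l))
    ... | isOld v with place v
    ...   | atQ q  = φ-Q q
    ...   | atQ' q = φ-Q' q
    ...   | atW p  = trans (φ-pathV (opposite p)) (cong (oldV k ∘ inW) (opposite-involutive p))

    Inner : Fin m → Set
    Inner r = Σ (Fin k) λ l → r ≡ suc (inject₁ l)

    classify : ∀ r → (r ≡ firstW) ⊎ (r ≡ lastW) ⊎ Inner r
    classify r = byPosition (position r)
      where
      byPosition : ∀ {r} → Position r → (r ≡ firstW) ⊎ (r ≡ lastW) ⊎ Inner r
      byPosition first     = inj₁ refl
      byPosition last      = inj₂ (inj₁ refl)
      byPosition (inner l) = inj₂ (inj₂ (l , refl))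

    inner-notEnd : ∀ {r} → Inner r → ¬ Ends (toℕ r)
    inner-notEnd (l , refl) (inj₂ e) = 1+n≰n (subst (λ z → suc z ≤ k) (trans (sym (toℕ-inject₁ l)) (suc-injective e)) (toℕ<n l))

    inner≢first : ∀ {r} → Inner r → r ≢ firstW
    inner≢first i refl = inner-notEnd i (inj₁ refl)

    inner≢last : ∀ {r} → Inner r → r ≢ lastW
    inner≢last i refl = inner-notEnd i (inj₂ toℕ-lastW)

    inner-opposite : ∀ {r} → Inner r → Inner (opposite r)
    inner-opposite {r} i with classify (opposite r)
    ... | inj₁ e        = ⊥-elim (inner≢last i (trans (sym (opposite-involutive r)) (trans (cong opposite e) opposite-first)))
    ... | inj₂ (inj₁ e) = ⊥-elim (inner≢first i (trans (sym (opposite-involutive r)) (trans (cong opposite e) opposite-last)))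
    ... | inj₂ (inj₂ i') = i'

    onlyEnds : ∀ (f : Fin m → Bool) → (∀ r → Inner r → f r ≡ false) → ∀ r → f r ≡ true → Ends (toℕ r)
    onlyEnds f h r e with classify r
    ... | inj₁ refl        = inj₁ refl
    ... | inj₂ (inj₁ refl) = inj₂ toℕ-lastW
    ... | inj₂ (inj₂ i)    = ⊥-elim (true≢false (trans (sym e) (h r i)))

    InPair-opposite : ∀ c r → InPair c (toℕ (opposite r)) → InPair (M ∸ suc c) (toℕ r)
    InPair-opposite c r h =
      subst (InPair (M ∸ suc c)) (trans (sym (opposite-prop (opposite r))) (cong toℕ (opposite-involutive r)))
        (InPair-reflect M c (toℕ (opposite r)) (≤-pred (toℕ<n (opposite r))) h)

    edge-W : ∀ p → inEdge g₁ gₘ (inW p) ≡ (p =ᵇ firstW) ∨ (p =ᵇ lastW)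
    edge-W p = cong₂ _∨_ (sameTest p firstW) (sameTest p lastW)
      where
      sameTest : ∀ p p' → inW p =ᵇ inW p' ≡ p =ᵇ p'
      sameTest p p' = bool-ext (λ e → subst (λ z → p =ᵇ z ≡ true) (↑ˡ-injective b p p' (↑ʳ-injective a _ _ (=ᵇ-sound e))) (=ᵇ-refl p))
                               (λ e → subst (λ z → inW p =ᵇ inW z ≡ true) (=ᵇ-sound e) (=ᵇ-refl (inW p)))

    edge-Q : ∀ q → inEdge g₁ gₘ (inQ q) ≡ false
    edge-Q q = cong₂ _∨_ (=ᵇ-false (↑ˡ≢↑ʳ a (m + b) q _)) (=ᵇ-false (↑ˡ≢↑ʳ a (m + b) q _))

    edge-Q' : ∀ q → inEdge g₁ gₘ (inQ' q) ≡ false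
    edge-Q' q = cong₂ _∨_ (=ᵇ-false (λ e → ↑ˡ≢↑ʳ m b _ q (sym (↑ʳ-injective a _ _ e))))
                          (=ᵇ-false (λ e → ↑ˡ≢↑ʳ m b _ q (sym (↑ʳ-injective a _ _ e))))

    endsShape : ∀ {x y} I → Shape x y I → d I firstW ≡ true → d I lastW ≡ true →
      BraidDeleted Ends I × Completes y x (m ∸ 2) I
    endsShape I (untouched h _)  e₀ eₘ = ⊥-elim (h firstW e₀)
    endsShape I (lastOut h _)    e₀ eₘ with h firstW e₀
    ... | ()
    endsShape I (firstOut h _)   e₀ eₘ with trans (sym toℕ-lastW) (h lastW eₘ)
    ... | ()
    endsShape I (pairOut c h _)  e₀ eₘ = ⊥-elim (InPair-far 0 (suc m') (h firstW e₀) (subst (InPair c) toℕ-lastW (h lastW eₘ)))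
    endsShape I (endsOut h c)    e₀ eₘ = h , c

    D Pv : Subset (k ⊕ NN) → Fin m → Bool
    D τ r  = lookup τ (oldV k (inW r))
    Pv τ r = lookup τ (pathV r)

    newIn' : Subset (k ⊕ NN) → Fin k → Bool
    newIn' τ l = lookup τ (newV k l)

    old₀ old₋ old₊ : Subset (k ⊕ NN) → Subset NN
    old₀ τ = tabulate (λ v → lookup τ (oldV k v))
    old₋ τ = tabulate (λ v → lookup τ (oldV k v) ∧ not (inEdge g₁ gₘ v))
    old₊ τ = tabulate (λ v → lookup τ (oldV k v) ∨ inEdge g₁ gₘ v)

    d-old₀ : ∀ τ p → d (old₀ τ) p ≡ D τ p
    d-old₀ τ p = lookup∘tabulate _ (inW p)
    d-old₋ : ∀ τ p → d (old₋ τ) p ≡ D τ p ∧ not ((p =ᵇ firstW) ∨ (p =ᵇ lastW))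
    d-old₋ τ p = trans (lookup∘tabulate _ (inW p)) (cong (λ z → D τ p ∧ not z) (edge-W p))
    d-old₊ : ∀ τ p → d (old₊ τ) p ≡ D τ p ∨ ((p =ᵇ firstW) ∨ (p =ᵇ lastW))
    d-old₊ τ p = trans (lookup∘tabulate _ (inW p)) (cong (D τ p ∨_) (edge-W p))

    d-old₊-first : ∀ τ → d (old₊ τ) firstW ≡ true
    d-old₊-first τ = trans (d-old₊ τ firstW) (BP.∨-zeroʳ (D τ firstW))
    d-old₊-last : ∀ τ → d (old₊ τ) lastW ≡ true
    d-old₊-last τ = trans (d-old₊ τ lastW) (trans (cong (λ z → D τ lastW ∨ ((lastW =ᵇ firstW) ∨ z)) (=ᵇ-refl lastW))
                      (trans (cong (D τ lastW ∨_) (BP.∨-zeroʳ (lastW =ᵇ firstW))) (BP.∨-zeroʳ (D τ lastW))))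

    AgreesOutside : Subset (k ⊕ NN) → Subset NN → Set
    AgreesOutside τ J = (∀ q → lookup J (inQ q) ≡ lookup τ (oldV k (inQ q))) × (∀ q → lookup J (inQ' q) ≡ lookup τ (oldV k (inQ' q)))

    completes-transfer : ∀ {z w ℓ} τ I J → AgreesOutside τ I → AgreesOutside τ J → Completes z w ℓ I → Completes z w ℓ J
    completes-transfer τ I J (onQ , onQ') (onQ₂ , onQ'₂) =
      completes-resp I J (λ q → trans (onQ q) (sym (onQ₂ q))) (λ q → trans (onQ' q) (sym (onQ'₂ q)))

    agrees-old₀ : ∀ τ → AgreesOutside τ (old₀ τ)
    agrees-old₀ τ = (λ q → lookup∘tabulate _ (inQ q)) , (λ q → lookup∘tabulate _ (inQ' q))

    agrees-old₋ : ∀ τ → AgreesOutside τ (old₋ τ)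
    agrees-old₋ τ = (λ q → trans (lookup∘tabulate _ (inQ q)) (minus (inQ q) (edge-Q q))) ,
                    (λ q → trans (lookup∘tabulate _ (inQ' q)) (minus (inQ' q) (edge-Q' q)))
      where
      minus : ∀ v → inEdge g₁ gₘ v ≡ false → (lookup τ (oldV k v) ∧ not (inEdge g₁ gₘ v)) ≡ lookup τ (oldV k v)
      minus v e rewrite e = BP.∧-identityʳ _

    agrees-old₊ : ∀ τ → AgreesOutside τ (old₊ τ)
    agrees-old₊ τ = (λ q → trans (lookup∘tabulate _ (inQ q)) (plus (inQ q) (edge-Q q))) ,
                    (λ q → trans (lookup∘tabulate _ (inQ' q)) (plus (inQ' q) (edge-Q' q)))
      where
      plus : ∀ v → inEdge g₁ gₘ v ≡ false → (lookup τ (oldV k v) ∨ inEdge g₁ gₘ v) ≡ lookup τ (oldV k v)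
      plus v e rewrite e = BP.∨-identityʳ _

    reflect : Subset (k ⊕ NN) → Subset (k ⊕ NN)
    reflect τ = tabulate (lookup τ ∘ φ)

    D-reflect : ∀ τ r → D (reflect τ) r ≡ Pv τ (opposite r)
    D-reflect τ r = trans (lookup∘tabulate _ (oldV k (inW r))) (cong (lookup τ) (φ-W r))

    Pv-reflect : ∀ τ r → Pv (reflect τ) r ≡ D τ (opposite r)
    Pv-reflect τ r = trans (lookup∘tabulate _ (pathV r)) (cong (lookup τ) (φ-pathV r))

    new-reflect : ∀ τ l → newIn' (reflect τ) l ≡ D τ (opposite (suc (inject₁ l)))
    new-reflect τ l = trans (lookup∘tabulate _ (newV k l)) (cong (lookup τ) (φ-new l))

    agrees-reflect : ∀ τ → AgreesOutside τ (old₀ (reflect τ))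
    agrees-reflect τ =
      (λ q → trans (lookup∘tabulate _ (inQ q)) (trans (lookup∘tabulate (lookup τ ∘ φ) (oldV k (inQ q))) (cong (lookup τ) (φ-Q q)))) ,
      (λ q → trans (lookup∘tabulate _ (inQ' q)) (trans (lookup∘tabulate (lookup τ ∘ φ) (oldV k (inQ' q))) (cong (lookup τ) (φ-Q' q))))

    PathWithin' : Fin n → Fin n → Subset (k ⊕ NN) → ℕ → Set
    PathWithin' x y = ExplicitSubdivision.PathWithin k (Δ x y) g₁ gₘ

    pathWithin⇒ : ∀ x y τ p → PathWithin' x y τ p → ∀ r → Pv τ r ≡ true → InPair p (toℕ r)
    pathWithin⇒ x y τ p (onNew , onS , onT) r e with classify r
    ... | inj₁ refl            = onS e
    ... | inj₂ (inj₁ refl)     = subst (InPair p) (sym toℕ-lastW) (onT (trans (sym (cong (lookup τ) pathV-last)) e))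
    ... | inj₂ (inj₂ (l , refl)) = subst (InPair p) (sym (cong suc (toℕ-inject₁ l))) (onNew l (trans (sym (cong (lookup τ) (pathV-inner l))) e))

    pathWithin⇐ : ∀ x y τ p → (∀ r → Pv τ r ≡ true → InPair p (toℕ r)) → PathWithin' x y τ p
    pathWithin⇐ x y τ p h =
      (λ l e → subst (InPair p) (cong suc (toℕ-inject₁ l)) (h (suc (inject₁ l)) (trans (cong (lookup τ) (pathV-inner l)) e))) ,
      (λ e → h firstW e) ,
      (λ e → subst (InPair p) toℕ-lastW (h lastW (trans (cong (lookup τ) pathV-last) e)))

    pathAtOpposite : ∀ τ r → Pv τ (opposite r) ≡ true →
      (r ≡ lastW × D τ firstW ≡ true) ⊎ (r ≡ firstW × D τ lastW ≡ true) ⊎ (Inner r × Σ (Fin k) λ l → newIn' τ l ≡ true)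
    pathAtOpposite τ r e with classify (opposite r)
    ... | inj₁ o≡ = inj₁ (trans (sym (opposite-involutive r)) (trans (cong opposite o≡) opposite-first) , subst (λ z → Pv τ z ≡ true) o≡ e)
    ... | inj₂ (inj₁ o≡) = inj₂ (inj₁ (trans (sym (opposite-involutive r)) (trans (cong opposite o≡) opposite-last) ,
                             trans (sym (cong (lookup τ) pathV-last)) (subst (λ z → Pv τ z ≡ true) o≡ e)))
    ... | inj₂ (inj₂ (l , o≡)) = inj₂ (inj₂ (subst Inner (opposite-involutive r) (inner-opposite (l , o≡)) ,
                                  l , trans (sym (cong (lookup τ) (pathV-inner l))) (subst (λ z → Pv τ z ≡ true) o≡ e)))

    open CoxeterFacts C using (_∼_; ContainsRed; ∼-sym)

    module Transfer (x y : Fin n) (x≢y : x ≢ y) (br : altL x y m ∼ altL y x m)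
      (A₃ : ¬ ContainsRed (toList (Q Vec.++ alt x y (suc m') Vec.++ Q')) π)
      (B₃ : ¬ ContainsRed (toList (Q Vec.++ alt y x (suc m') Vec.++ Q')) π) where
      module FX = Faces x y x≢y br A₃ B₃
      module FY = Faces y x (x≢y ∘ sym) (∼-sym br) B₃ A₃

      KF : Fin n → Fin n → Subset (k ⊕ NN) → Set
      KF z w = KFace k (Δ z w) g₁ gₘ

      0≢M : 0 ≢ M
      0≢M ()

      deleted-reflect : ∀ τ r → d (old₀ (reflect τ)) r ≡ true → Pv τ (opposite r) ≡ true
      deleted-reflect τ r e = trans (sym (D-reflect τ r)) (trans (sym (d-old₀ (reflect τ) r)) e)

      reflectedDeletion : ∀ τ (P : ℕ → Set) → (∀ l → newIn' τ l ≡ false) →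
        (D τ firstW ≡ true → P M) → (D τ lastW ≡ true → P 0) → BraidDeleted P (old₀ (reflect τ))
      reflectedDeletion τ P none onFirst onLast r e with pathAtOpposite τ r (deleted-reflect τ r e)
      ... | inj₁ (refl , d₀)        = subst P (sym toℕ-lastW) (onFirst d₀)
      ... | inj₂ (inj₁ (refl , dₘ)) = onLast dₘ
      ... | inj₂ (inj₂ (_ , l , e')) = ⊥-elim (true≢false (trans (sym e') (none l)))

      noInnerPath : ∀ τ → (∀ l → newIn' τ l ≡ false) → ∀ r → Inner r → Pv τ (opposite r) ≡ false
      noInnerPath τ none r i = ¬-not λ e → onPath (pathAtOpposite τ r e)
        where
        onPath : _ → ⊥
        onPath (inj₁ (r≡ , _))        = inner≢last i r≡
        onPath (inj₂ (inj₁ (r≡ , _))) = inner≢first i r≡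
        onPath (inj₂ (inj₂ (_ , l , e'))) = true≢false (trans (sym e') (none l))

      reflect-notBoth : ∀ τ → ¬ (D τ firstW ≡ true × D τ lastW ≡ true) → ¬ (D (reflect τ) firstW ≡ true × D (reflect τ) lastW ≡ true)
      reflect-notBoth τ notBoth (e₀ , eₘ) =
        notBoth (trans (sym (trans (D-reflect τ lastW) (cong (Pv τ) opposite-last))) eₘ ,
                 trans (sym (trans (D-reflect τ firstW) (trans (cong (Pv τ) opposite-first) (cong (lookup τ) pathV-last)))) e₀)

      reflect-noNew : ∀ τ → (∀ r → Inner r → D τ r ≡ false) → ∀ l → newIn' (reflect τ) l ≡ false
      reflect-noNew τ h l = trans (new-reflect τ l) (h _ (inner-opposite (l , refl)))

      endsOnly⇒noInner : ∀ τ → BraidDeleted Ends (old₀ τ) → ∀ r → Inner r → D τ r ≡ false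
      endsOnly⇒noInner τ h r i = ¬-not λ e → inner-notEnd i (h r (trans (d-old₀ τ r) e))

      through-reflect : ∀ {z w ℓ} τ → Completes z w ℓ (old₀ τ) → Completes z w ℓ (old₀ (reflect τ))
      through-reflect τ = completes-transfer τ (old₀ τ) (old₀ (reflect τ)) (agrees-old₀ τ) (agrees-reflect τ)

      -- A face meeting the path: its part with {g₁,g_m} has the endsOut shape,
      -- so it deletes no inner braid position; φ(τ) then avoids the path and
      -- deletes the reflected pair of path positions.
      transfer-meets : ∀ τ → Face (Δ x y) (old₊ τ) → ∀ p → PathWithin' x y τ p → KF y x (reflect τ)
      transfer-meets τ F₊ p within =
        avoidsPath (reflect-noNew τ noInnerDeleted)
                   (FY.shape⇒face (old₀ (reflect τ)) (pairOut (M ∸ suc p) reflectedPair completes))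
                   notBoth
        where
        ends = endsShape (old₊ τ) (FX.face⇒shape (old₊ τ) F₊) (d-old₊-first τ) (d-old₊-last τ)
        completes = completes-transfer τ (old₊ τ) (old₀ (reflect τ)) (agrees-old₊ τ) (agrees-reflect τ) (proj₂ ends)
        noInnerDeleted : ∀ r → Inner r → D τ r ≡ false
        noInnerDeleted r i = ¬-not λ e → inner-notEnd i (proj₁ ends r (trans (d-old₊ τ r) (cong (_∨ _) e)))
        onPath = pathWithin⇒ x y τ p within
        reflectedPair : BraidDeleted (InPair (M ∸ suc p)) (old₀ (reflect τ))
        reflectedPair r e = InPair-opposite p r (onPath (opposite r) (deleted-reflect τ r e))
        notBoth : ¬ (D (reflect τ) firstW ≡ true × D (reflect τ) lastW ≡ true)
        notBoth (e₀ , eₘ) = InPair-far 0 (suc m')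
          (subst (InPair p) (cong toℕ opposite-last) (onPath (opposite lastW) (trans (sym (D-reflect τ lastW)) eₘ)))
          (subst (InPair p) toℕ-lastW (onPath (opposite firstW) (trans (sym (D-reflect τ firstW)) e₀)))

      endsFace : ∀ τ → Completes x y (m ∸ 2) (old₀ τ) → ∀ J → AgreesOutside (reflect τ) J →
        (∀ r → Inner r → d J r ≡ false) → Face (Δ y x) J
      endsFace τ c J agrees noInner = FY.shape⇒face J (endsOut (onlyEnds (d J) noInner)
        (completes-transfer (reflect τ) (old₀ (reflect τ)) J (agrees-old₀ (reflect τ)) agrees (through-reflect τ c)))

      -- A face avoiding the path and deleting a pair {c, c+1}: if the pair has
      -- an inner position, φ(τ) meets the path in the reflected pair;
      -- otherwise φ(τ) deletes an end of the braid factor.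
      transfer-pair : ∀ τ → (∀ l → newIn' τ l ≡ false) → ¬ (D τ firstW ≡ true × D τ lastW ≡ true) →
        ∀ c → BraidDeleted (InPair c) (old₀ τ) → Completes x y (m ∸ 2) (old₀ τ) → KF y x (reflect τ)
      transfer-pair τ none notBoth c h cmp with any? (λ l → D τ (opposite (suc (inject₁ l))) Data.Bool.≟ true)
      ... | yes (l , e) = meetsPath (l , trans (new-reflect τ l) e)
              (endsFace τ cmp (old₋ (reflect τ)) (agrees-old₋ (reflect τ)) λ r i →
                trans (d-old₋ (reflect τ) r) (cong (_∧ _) (trans (D-reflect τ r) (noInnerPath τ none r i))))
              (endsFace τ cmp (old₊ (reflect τ)) (agrees-old₊ (reflect τ)) λ r i →
                trans (d-old₊ (reflect τ) r) (cong₂ _∨_ (trans (D-reflect τ r) (noInnerPath τ none r i))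
                                                       (cong₂ _∨_ (=ᵇ-false (inner≢first i)) (=ᵇ-false (inner≢last i)))))
              (M ∸ suc c , pathWithin⇐ y x (reflect τ) (M ∸ suc c) λ r e →
                InPair-opposite c r (h (opposite r) (trans (d-old₀ τ _) (trans (sym (Pv-reflect τ r)) e))))
      ... | no noInner = avoidsPath (λ l → trans (new-reflect τ l) (¬-not λ e → noInner (l , e)))
              (endsFace τ cmp (old₀ (reflect τ)) (agrees-old₀ (reflect τ)) λ r i →
                trans (d-old₀ (reflect τ) r) (trans (D-reflect τ r) (noInnerPath τ none r i)))
              (reflect-notBoth τ notBoth)

      -- A face avoiding the path: φ(τ) avoids the path as well (unless τ
      -- deletes an inner pair) and has the mirror shape.
      transfer-avoids : ∀ τ → (∀ l → newIn' τ l ≡ false) → ¬ (D τ firstW ≡ true × D τ lastW ≡ true) →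
        Shape x y (old₀ τ) → KF y x (reflect τ)
      transfer-avoids τ none notBoth (untouched h c) =
        avoidsPath (reflect-noNew τ (endsOnly⇒noInner τ (λ r e → ⊥-elim (h r e))))
          (FY.shape⇒face _ (untouched (reflectedDeletion τ (λ _ → ⊥) none (λ e → h firstW (trans (d-old₀ τ _) e))
                                                                (λ e → h lastW (trans (d-old₀ τ _) e)))
                                      (through-reflect τ (FY.completes-swap (old₀ τ) c))))
          (reflect-notBoth τ notBoth)
      transfer-avoids τ none notBoth (lastOut h c) =
        avoidsPath (reflect-noNew τ (endsOnly⇒noInner τ (λ r e → inj₂ (h r e))))
          (FY.shape⇒face _ (firstOut (reflectedDeletion τ (_≡ 0) none (λ e → ⊥-elim (0≢M (h firstW (trans (d-old₀ τ _) e)))) (λ _ → refl))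
                                     (through-reflect τ c)))
          (reflect-notBoth τ notBoth)
      transfer-avoids τ none notBoth (firstOut h c) =
        avoidsPath (reflect-noNew τ (endsOnly⇒noInner τ (λ r e → inj₁ (h r e))))
          (FY.shape⇒face _ (lastOut (reflectedDeletion τ (_≡ M) none (λ _ → refl) (λ e → ⊥-elim (0≢M (sym (trans (sym toℕ-lastW) (h lastW (trans (d-old₀ τ _) e)))))))
                                    (through-reflect τ c)))
          (reflect-notBoth τ notBoth)
      transfer-avoids τ none notBoth (endsOut h c) =
        avoidsPath (reflect-noNew τ (endsOnly⇒noInner τ h))
          (FY.shape⇒face _ (byFirst (D τ firstW) refl))
          (reflect-notBoth τ notBoth)
        where
        -- as not both ends are deleted, φ(τ) deletes a single end
        byFirst : ∀ b → D τ firstW ≡ b → Shape y x (old₀ (reflect τ))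
        byFirst true e₀ = pairOut (suc (suc m'))
          (reflectedDeletion τ (InPair (suc (suc m'))) none (λ _ → inj₂ refl) (λ eₘ → ⊥-elim (notBoth (e₀ , eₘ)))) (through-reflect τ c)
        byFirst false e₀ = pairOut 0
          (reflectedDeletion τ (InPair 0) none (λ e → ⊥-elim (true≢false (trans (sym e) e₀))) (λ _ → inj₁ refl)) (through-reflect τ c)
      transfer-avoids τ none notBoth (pairOut c h cmp) = transfer-pair τ none notBoth c h cmp

      transfer : ∀ τ → KF x y τ → KF y x (reflect τ)
      transfer τ (avoidsPath none F notBoth) = transfer-avoids τ none notBoth (FX.face⇒shape (old₀ τ) F)
      transfer τ (meetsPath _ _ F₊ (p , within)) = transfer-meets τ F₊ p within

  module Isomorphisms {n} (C : CoxeterMatrix n) {a b : ℕ} (Q : Vec (Fin n) a) (Q' : Vec (Fin n) b) (π : Word n) (m' : ℕ) where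
    open PathReversal C Q Q' π m' public
    open CoxeterFacts C using (_∼_; ContainsRed; ∼-sym)

    Subdivided : Fin n → Fin n → SC
    Subdivided x y = E k (Δ x y) g₁ gₘ

    module _ (x y : Fin n) (x≢y : x ≢ y) (br : altL x y m ∼ altL y x m)
      (A₃ : ¬ ContainsRed (toList (Q Vec.++ alt x y (suc m') Vec.++ Q')) π)
      (B₃ : ¬ ContainsRed (toList (Q Vec.++ alt y x (suc m') Vec.++ Q')) π) where

      subdivisions-iso : Subdivided x y ≅ Subdivided y x
      subdivisions-iso = mkIso record
        { to = φ ; from = φ ; from-to = φ-involutive ; to-from = λ _ _ w _ → φ-involutive w
        ; to-face = λ σ F → subst (KFace k (Δ y x) g₁ gₘ) (tabulate-cong (λ w → sym (drop-test σ w))) (Transfer.transfer x y x≢y br A₃ B₃ σ F)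
        ; from-face = λ τ F → Transfer.transfer y x (x≢y ∘ sym) (∼-sym br) B₃ A₃ τ F }
        where
        drop-test : ∀ (σ : Subset (k ⊕ NN)) w → (lookup σ (φ w) ∧ ⌊ φ (φ w) Fin.≟ w ⌋) ≡ lookup σ (φ w)
        drop-test σ w = trans (cong (lookup σ (φ w) ∧_) (≟-true (φ-involutive w))) (BP.∧-identityʳ _)

      -- If no face completes with s_y s_x ⋯ of length m-2 (condition (B₂)),
      -- subdividing Δ(Q·(s_x s_y ⋯)·Q') creates no new face.
      module _ (noEnds : ∀ I → ¬ Completes y x (m ∸ 2) I) where
        private
          module FX = Faces x y x≢y br A₃ B₃

        notBothEnds : ∀ σ → Face (Δ x y) σ → ¬ (d σ firstW ≡ true × d σ lastW ≡ true)
        notBothEnds σ F (e₀ , eₘ) = noEnds σ (proj₂ (endsShape σ (FX.face⇒shape σ F) e₀ eₘ))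

        noNewVertex : ∀ τ → KFace k (Δ x y) g₁ gₘ τ → ∀ l → lookup τ (newV k l) ≡ false
        noNewVertex τ (avoidsPath none _ _) l = none l
        noNewVertex τ (meetsPath _ _ F₊ _) l = ⊥-elim (notBothEnds (old₊ τ) F₊ (d-old₊-first τ , d-old₊-last τ))

        forgetNew : Fin (k ⊕ NN) → Fin NN
        forgetNew w with vertexView k {NN} w
        ... | isOld v = v
        ... | isNew _ = g₁

        forgetNew-old : ∀ v → forgetNew (oldV k v) ≡ v
        forgetNew-old v rewrite vertexView-old k v = refl

        trivial-subdivision : Δ x y ≅ Subdivided x y
        trivial-subdivision = mkIso record
          { to = oldV k ; from = forgetNew ; from-to = forgetNew-old ; to-from = onlyOld ; to-face = toFace ; from-face = fromFace }
          where
          onlyOld : ∀ τ → KFace k (Δ x y) g₁ gₘ τ → ∀ w → lookup τ w ≡ true → oldV k (forgetNew w) ≡ w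
          onlyOld τ F w e with vertexView k {NN} w
          ... | isOld v = refl
          ... | isNew l = ⊥-elim (true≢false (trans (sym e) (noNewVertex τ F l)))
          embed : Subset NN → Subset (k ⊕ NN)
          embed σ = tabulate (λ w → lookup σ (forgetNew w) ∧ ⌊ oldV k (forgetNew w) Fin.≟ w ⌋)
          embed-old : ∀ σ v → lookup (embed σ) (oldV k v) ≡ lookup σ v
          embed-old σ v = trans (lookup∘tabulate _ (oldV k v))
            (trans (cong (λ z → lookup σ z ∧ ⌊ oldV k z Fin.≟ oldV k v ⌋) (forgetNew-old v))
              (trans (cong (lookup σ v ∧_) (≟-true refl)) (BP.∧-identityʳ _)))
          embed-new : ∀ σ l → lookup (embed σ) (newV k l) ≡ false
          embed-new σ l = trans (lookup∘tabulate _ (newV k l))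
            (trans (cong (lookup σ (forgetNew (newV k l)) ∧_) (≟-false (oldV≢newV k (forgetNew (newV k l)) l))) (BP.∧-zeroʳ _))
          toFace : ∀ σ → Face (Δ x y) σ → KFace k (Δ x y) g₁ gₘ (embed σ)
          toFace σ F = avoidsPath (embed-new σ)
            (subst (Face (Δ x y)) (sym (subset-ext λ v → trans (lookup∘tabulate _ v) (embed-old σ v))) F)
            (λ (e₀ , eₘ) → notBothEnds σ F (trans (sym (embed-old σ g₁)) e₀ , trans (sym (embed-old σ gₘ)) eₘ))
          fromFace : ∀ τ → KFace k (Δ x y) g₁ gₘ τ → Face (Δ x y) (tabulate (λ v → lookup τ (oldV k v)))
          fromFace τ (avoidsPath _ F _) = F
          fromFace τ (meetsPath _ _ F₊ _) = ⊥-elim (notBothEnds (old₊ τ) F₊ (d-old₊-first τ , d-old₊-last τ))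

  braidMove : ∀ {n} (C : CoxeterMatrix n) (i j : Fin n) → i ≢ j → (m : ℕ) → (h : 3 < m) →
      Coxeter._∼_ C (altL i j m) (altL j i m) →
      ∀ {a b} (Q : Vec (Fin n) a) (Q' : Vec (Fin n) b) (π : Word n) →
      let A = λ (k : ℕ) → ¬ Coxeter.ContainsRed C (toList (Q Vec.++ alt i j (m ∸ k) Vec.++ Q')) π
          B = λ (k : ℕ) → ¬ Coxeter.ContainsRed C (toList (Q Vec.++ alt j i (m ∸ k) Vec.++ Q')) π
          Δ₁ = subwordComplex C (Q Vec.++ alt i j m Vec.++ Q') π
          Δ₂ = subwordComplex C (Q Vec.++ alt j i m Vec.++ Q') π
          f₁ = posIn a m b (firstIdx m (0<m h))
          fₘ = posIn a m b (lastIdx m (0<m h))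
      in A 3 → B 3 →
         ((A 2 → B 2 → Δ₁ ≅ Δ₂)
         × (¬ A 2 → B 2 → Δ₁ ≅ SubK (m ∸ 2) Δ₂ f₁ fₘ)
         × (A 2 → ¬ B 2 → Δ₂ ≅ SubK (m ∸ 2) Δ₁ f₁ fₘ)
         × (¬ A 2 → ¬ B 2 → Σ SC λ Δ̃ → (Δ̃ ≅ SubK (m ∸ 2) Δ₁ f₁ fₘ) × (Δ̃ ≅ SubK (m ∸ 2) Δ₂ f₁ fₘ)))
  braidMove C i j i≢j (suc (suc (suc (suc m')))) (s≤s (s≤s (s≤s (s≤s z≤n)))) br {a} {b} Q Q' π A₃ B₃ =
      (λ A₂ B₂ → ≅-trans (Δ₁≅Sub₁ B₂) (≅-trans Sub₁≅Sub₂ (≅-sym (Δ₂≅Sub₂ A₂)))) ,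
      (λ _ B₂ → ≅-trans (Δ₁≅Sub₁ B₂) (≅-trans Sub₁≅Sub₂ (≅-sym SubK₂))) ,
      (λ A₂ _ → ≅-trans (Δ₂≅Sub₂ A₂) (≅-trans (≅-sym Sub₁≅Sub₂) (≅-sym SubK₁))) ,
      (λ _ _ → _ , ≅-refl , ≅-trans SubK₁ (≅-trans Sub₁≅Sub₂ (≅-sym SubK₂)))
    where
    open Isomorphisms C Q Q' π m'
    open CoxeterFacts C using (∼-sym; ContainsRed)
    noCompletion : ∀ z w → ¬ ContainsRed (toList (Q Vec.++ alt z w (m ∸ 2) Vec.++ Q')) π → ∀ I → ¬ Completes z w (m ∸ 2) I
    noCompletion z w A₂ I c = A₂ (completes⇒contains z w I ≤-refl c)
    g₁≢gₘ : g₁ ≢ gₘ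
    g₁≢gₘ e with ↑ˡ-injective b _ _ (↑ʳ-injective a _ _ e)
    ... | ()
    SubK₁ : SubK k (Δ i j) g₁ gₘ ≅ Subdivided i j
    SubK₁ = subK≅E (suc m') (Δ i j) g₁ gₘ g₁≢gₘ
    SubK₂ : SubK k (Δ j i) g₁ gₘ ≅ Subdivided j i
    SubK₂ = subK≅E (suc m') (Δ j i) g₁ gₘ g₁≢gₘ
    Sub₁≅Sub₂ : Subdivided i j ≅ Subdivided j i
    Sub₁≅Sub₂ = subdivisions-iso i j i≢j br A₃ B₃
    Δ₁≅Sub₁ : ¬ ContainsRed (toList (Q Vec.++ alt j i (m ∸ 2) Vec.++ Q')) π → Δ i j ≅ Subdivided i j
    Δ₁≅Sub₁ B₂ = trivial-subdivision i j i≢j br A₃ B₃ (noCompletion j i B₂)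
    Δ₂≅Sub₂ : ¬ ContainsRed (toList (Q Vec.++ alt i j (m ∸ 2) Vec.++ Q')) π → Δ j i ≅ Subdivided j i
    Δ₂≅Sub₂ A₂ = trivial-subdivision j i (i≢j ∘ sym) (∼-sym br) B₃ A₃ (noCompletion i j A₂)

open import Data.Nat using (ℕ; _<_; _∸_)
open import Data.Fin using (Fin)
open import Data.Vec using (Vec; _++_; toList)
open import Data.Product using (Σ; _×_)
open import Relation.Nullary using (¬_)
open import Relation.Binary.PropositionalEquality using (_≢_)
open BraidMoves using (braidMove)
open Words using (module CoxeterFacts)

mainTheorem1 : ∀ {n} (C : CoxeterMatrix n) → Coxeter.FiniteW C →
    (i j : Fin n) → i ≢ j → (h : 3 < CoxeterMatrix.m C i j) →
    ∀ {a b} (Q : Vec (Fin n) a) (Q' : Vec (Fin n) b) (π : Word n) →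
    let m = CoxeterMatrix.m C i j
        A = λ (k : ℕ) → ¬ Coxeter.ContainsRed C (toList (Q ++ alt i j (m ∸ k) ++ Q')) π
        B = λ (k : ℕ) → ¬ Coxeter.ContainsRed C (toList (Q ++ alt j i (m ∸ k) ++ Q')) π
        Δ₁ = subwordComplex C (Q ++ alt i j m ++ Q') π
        Δ₂ = subwordComplex C (Q ++ alt j i m ++ Q') π
        f₁ = posIn a m b (firstIdx m (0<m h))
        fₘ = posIn a m b (lastIdx m (0<m h))
        g₁ = posIn a m b (firstIdx m (0<m h))
        gₘ = posIn a m b (lastIdx m (0<m h))
    in A 3 → B 3 →
       ((A 2 → B 2 → Δ₁ ≅ Δ₂)
       × (¬ A 2 → B 2 → Δ₁ ≅ SubK (m ∸ 2) Δ₂ g₁ gₘ)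
       × (A 2 → ¬ B 2 → Δ₂ ≅ SubK (m ∸ 2) Δ₁ f₁ fₘ)
       × (¬ A 2 → ¬ B 2 → Σ SC λ Δ̃ → (Δ̃ ≅ SubK (m ∸ 2) Δ₁ f₁ fₘ) × (Δ̃ ≅ SubK (m ∸ 2) Δ₂ g₁ gₘ)))
mainTheorem1 C _ i j i≢j h Q Q' π =
  braidMove C i j i≢j (CoxeterMatrix.m C i j) h (CoxeterFacts.braid-relation C i j) Q Q' π
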